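{- Let $n\in\mathbb{N}$ and let $\alpha$ be a unit-interval parking function of length $n$ that decomposes into $k$ component primes, the $j$-th of which has length $\ell(j)$. Then the orbit of $\alpha$ under the action of $S_n$ on unit-interval parking functions induced (via face labeling) from the coordinate-permutation action of $S_n$ on the faces of the permutohedron $P(n)$ has size $\dfrac{n!}{\prod_{j\in[k]}\ell(j)!}$.
   Context: $P(n)=\operatorname{conv}\{(w(1),\dots,w(n)): w\text{ a permutation of }[n]\}$. A parking function of length $n$ is $\alpha=(a_1,\dots,a_n)\in[n]^n$ such that cars $1,\dots,n$, arriving in order and each parking in the first free spot $\ge a_i$, all park in spots $1,\dots,n$; it is unit-interval if each car parks at most one spot past its preference. Breakpoints are $k$ with $|\{i:a_i\le k\}|=k$; with breakpoints $b_1<\dots<b_k=n$ ($b_0=0$) the component primes have lengths $\ell(j)=b_j-b_{j-1}$. Each unit-interval parking function $\alpha$ labels the face $F_{B_1/\cdots/B_k}$ of $P(n)$, where $B_j=\{\sigma(b_{j-1}+1),\dots,\sigma(b_j)\}$ with $\sigma(t)$ the car parking in spot $t$, and $F_{B_1/\cdots/B_k}$ is the convex hull of the vertices $x$ with $x_i<x_{i'}$ whenever $i\in B_a,i'\in B_b,a<b$; this labeling is a bijection between unit-interval parking functions of length $n$ and faces of $P(n)$. The induced action: $\tau\cdot\alpha$ is the label of the face $\tau(F)$, where $F$ is the face labeled by $\alpha$ and $\tau$ permutes coordinates. -}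

module Defs where

open import Data.Nat using (ℕ; zero; suc; _+_; _*_; _∸_; _≤_; _<_; _≤?_; _<?_; _≟_)
open import Data.Nat using (_!)
open import Data.Bool using (Bool; true; false; if_then_else_)
open import Data.Fin using (Fin; toℕ)
open import Data.Vec using (Vec; []; _∷_; lookup; tabulate; toList)
open import Data.List as L using (List; []; _∷_; length; filter; applyUpTo)
open import Data.Nat.ListAction using (product)
open import Data.List.Membership.DecPropositional _≟_ using (_∈?_)
open import Data.Fin.Permutation using (Permutation′; _⟨$⟩ʳ_; _⟨$⟩ˡ_)
open import Data.Product using (Σ; ∃; ∃-syntax; _×_; _,_)
open import Relation.Nullary.Decidable using (does)
open import Relation.Binary.PropositionalEquality using (_≡_)

-- Preferences and spots are 1-based natural numbers, as in the paper.
-- A candidate parking function of length n is a vector α : Vec ℕ n,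
-- car i (a Fin n index) having preference lookup α i.

-- firstFree f occ a : first spot ≥ a not in occ (fuel f = length occ suffices,
-- since among a, a+1, …, a + length occ at least one spot is free).
firstFree : ℕ → List ℕ → ℕ → ℕ
firstFree zero    occ a = a
firstFree (suc f) occ a = if does (a ∈? occ) then firstFree f occ (suc a) else a

parkGo : ∀ {m} → List ℕ → Vec ℕ m → Vec ℕ m
parkGo occ []       = []
parkGo occ (a ∷ as) =
  let s = firstFree (length occ) occ a in s ∷ parkGo (s ∷ occ) as

spots : ∀ {n} → Vec ℕ n → Vec ℕ n
spots = parkGo []

IsParkingFunction : (n : ℕ) → Vec ℕ n → Set
IsParkingFunction n α =
  (∀ i → 1 ≤ lookup α i × lookup α i ≤ n) × (∀ i → lookup (spots α) i ≤ n)

IsUnitInterval : (n : ℕ) → Vec ℕ n → Set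
IsUnitInterval n α =
  IsParkingFunction n α × (∀ i → lookup (spots α) i ≤ suc (lookup α i))

countLe : ∀ {n} → ℕ → Vec ℕ n → ℕ
countLe k α = length (filter (λ a → a ≤? k) (toList α))

breakpoints : ∀ {n} → Vec ℕ n → List ℕ
breakpoints {n} α = filter (λ k → countLe k α ≟ k) (applyUpTo suc n)

diffs : ℕ → List ℕ → List ℕ
diffs prev []       = []
diffs prev (b ∷ bs) = (b ∸ prev) ∷ diffs b bs

componentLengths : ∀ {n} → Vec ℕ n → List ℕ
componentLengths α = diffs 0 (breakpoints α)

-- block index (0-based) of car i: number of breakpoints strictly below its spot;
-- car i ∈ B_j  iff  b_{j-1} < s_i ≤ b_j  iff  σ(t) = i for some b_{j-1} < t ≤ b_j
blockOf : ∀ {n} → Vec ℕ n → Fin n → ℕ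
blockOf α i = length (filter (λ b → b <? lookup (spots α) i) (breakpoints α))

IsVertex : (n : ℕ) → Vec ℕ n → Set
IsVertex n x = ∃[ w ] (x ≡ tabulate (λ i → suc (toℕ (_⟨$⟩ʳ_ {n} {n} w i))))

-- the face F_{B_1/…/B_k} labeled by α, given by its vertex set
-- (a face of a polytope is the convex hull of its vertices, so it is determined
-- by its vertex set)
FaceVertex : (n : ℕ) → Vec ℕ n → Vec ℕ n → Set
FaceVertex n α x =
  IsVertex n x × (∀ i i' → blockOf α i < blockOf α i' → lookup x i < lookup x i')

-- τ permutes coordinates: (τ·x)_{τ(i)} = x_i
permCoords : ∀ {n} → Permutation′ n → Vec ℕ n → Vec ℕ n
permCoords {n} τ x = tabulate (λ j → lookup x (_⟨$⟩ˡ_ {n} {n} τ j))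

InOrbit : (n : ℕ) → Vec ℕ n → Vec ℕ n → Set
InOrbit n α β =
  IsUnitInterval n β ×
  ∃[ τ ] (∀ x → (FaceVertex n β x → ∃[ y ] (FaceVertex n α y × x ≡ permCoords τ y))
              × (∃[ y ] (FaceVertex n α y × x ≡ permCoords τ y) → FaceVertex n β x))

factorialProduct : List ℕ → ℕ
factorialProduct ls = product (L.map (λ m → m !) ls)

-- A unit-interval parking function β is determined by its block word w i = blockOf β i: the
-- blocks occupy consecutive intervals of spots, each filled in order of arrival, the first car of
-- a block is lucky and every later car of the block prefers the spot just before its own
-- (β ≡ labelOf w). Conversely every word u labels a unit-interval parking function whose block
-- word is ordered like u. The vertex set of a face determines the order of its word, and
-- permuting coordinates by τ permutes the word. Hence the orbit of α corresponds to the
-- rearrangements of its block word, in which the letter of the j-th block occurs ℓ(j) times;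
-- there are n! / ∏ ℓ(j)! of them.

module Submission where

open import Defs
open import Data.Bool using (if_then_else_)
open import Data.Empty using (⊥-elim)
open import Data.Fin using (Fin; zero; suc; toℕ; fromℕ<)
import Data.Fin.Induction as FinInduction
open import Data.Fin.Permutation
  using (Permutation′; _⟨$⟩ʳ_; _⟨$⟩ˡ_; permutation; inverseˡ; inverseʳ; flip; _∘ₚ_; transpose)
import Data.Fin.Permutation.Components as PC
import Data.Fin.Properties as Finₚ
open import Data.List as List using (List; []; _∷_; length)
import Data.List.Properties as Listₚ
open import Data.List.Membership.Propositional using (_∈_; _∉_; find; lose)
open import Data.List.Membership.Propositional.Properties
  using (∈-filter⁺; ∈-filter⁻; ∈-applyUpTo⁺; ∈-applyUpTo⁻; ∈-map⁺; ∈-map⁻; ∈-concatMap⁺; ∈-concatMap⁻)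
open import Data.List.Relation.Binary.Disjoint.Propositional using (Disjoint)
open import Data.List.Relation.Unary.All using ([]; _∷_)
import Data.List.Relation.Unary.All as All
import Data.List.Relation.Unary.All.Properties as Allₚ
open import Data.List.Relation.Unary.AllPairs using (AllPairs; []; _∷_)
import Data.List.Relation.Unary.AllPairs as AllPairs
import Data.List.Relation.Unary.AllPairs.Properties as AllPairsₚ
open import Data.List.Relation.Unary.Any using (here; there)
open import Data.List.Relation.Unary.Unique.Propositional using (Unique)
import Data.List.Relation.Unary.Unique.Propositional.Properties as Uniqueₚ
open import Data.Nat
open import Data.Nat.Induction using (<-rec)
open import Data.Nat.ListAction using (sum)
open import Data.Nat.Properties
open import Algebra.Properties.CommutativeSemigroup *-commutativeSemigroup using (x∙yz≈y∙xz)
import Algebra.Properties.CommutativeMonoid.Sum +-0-commutativeMonoid as Sum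
open import Data.List.Membership.DecPropositional _≟_ using (_∈?_)
open import Data.Product using (Σ; ∃-syntax; _×_; _,_; proj₁; proj₂; map₁; map₂)
open import Data.Sum using (_⊎_; inj₁; inj₂)
open import Data.Unit using (tt)
open import Data.Vec using (Vec; []; _∷_; lookup; tabulate; toList)
open import Data.Vec.Properties using (tabulate∘lookup; lookup∘tabulate; tabulate-cong)
import Data.Vec.Properties as Vecₚ
open import Function using (_∘_)
open import Function.Bundles using (_⇔_; mk⇔; Equivalence)
import Function.Properties.Equivalence as ⇔
import Induction.WellFounded as WF
open import Level using (0ℓ)
open import Relation.Binary using (tri<; tri≈; tri>)
open import Relation.Binary.PropositionalEquality
open import Relation.Nullary using (¬_; Dec; yes; no; does; ¬?; _×-dec_; _⊎-dec_; contradiction)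
open import Relation.Nullary.Decidable using (does-⇔)
open import Relation.Unary using (Decidable)

-- Counting

-- Opaque, so that unifying count P? with count Q? compares the deciders.
opaque
  count : ∀ {n} {P : Fin n → Set} → Decidable P → ℕ
  count {zero}  P? = 0
  count {suc n} P? = (if does (P? zero) then 1 else 0) + count (P? ∘ suc)

opaque
  unfolding count

  count-head-yes : ∀ {n} {P : Fin (suc n) → Set} (P? : Decidable P) → P zero →
                   count P? ≡ suc (count (P? ∘ suc))
  count-head-yes P? p with P? zero
  ... | yes _  = refl
  ... | no ¬p = contradiction p ¬p

  count-head-no : ∀ {n} {P : Fin (suc n) → Set} (P? : Decidable P) → ¬ P zero → count P? ≡ count (P? ∘ suc)
  count-head-no P? ¬p with P? zero
  ... | yes p = contradiction p ¬p
  ... | no _  = refl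

  count-cong : ∀ {n} {P Q : Fin n → Set} (P? : Decidable P) (Q? : Decidable Q) →
               (∀ i → P i ⇔ Q i) → count P? ≡ count Q?
  count-cong {zero}  P? Q? P⇔Q = refl
  count-cong {suc n} P? Q? P⇔Q =
    cong₂ _+_ (cong (if_then 1 else 0) (does-⇔ (P⇔Q zero) (P? zero) (Q? zero)))
              (count-cong (P? ∘ suc) (Q? ∘ suc) (P⇔Q ∘ suc))

  count-all : ∀ {n} {P : Fin n → Set} → (P? : Decidable P) → (∀ i → P i) → count P? ≡ n
  count-all {zero}  P? all = refl
  count-all {suc n} P? all with P? zero
  ... | yes _  = cong suc (count-all (P? ∘ suc) (all ∘ suc))
  ... | no ¬p = contradiction (all zero) ¬p

  count-none : ∀ {n} {P : Fin n → Set} → (P? : Decidable P) → (∀ i → ¬ P i) → count P? ≡ 0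
  count-none {zero}  P? none = refl
  count-none {suc n} P? none with P? zero
  ... | yes p = contradiction p (none zero)
  ... | no _  = count-none (P? ∘ suc) (none ∘ suc)

  count-split : ∀ {n} {P Q : Fin n → Set} → (P? : Decidable P) (Q? : Decidable Q) →
                count P? ≡ count (λ i → P? i ×-dec Q? i) + count (λ i → P? i ×-dec ¬? (Q? i))
  count-split {zero}  P? Q? = refl
  count-split {suc n} P? Q? with P? zero | Q? zero | count-split (P? ∘ suc) (Q? ∘ suc)
  ... | yes _ | yes _ | eq = cong suc eq
  ... | yes _ | no _  | eq = trans (cong suc eq) (sym (+-suc _ _))
  ... | no _  | _     | eq = eq

  count-witness : ∀ {n} {P : Fin n → Set} → (P? : Decidable P) → 0 < count P? → ∃[ i ] P i
  count-witness {suc n} P? pos with P? zero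
  ... | yes p = zero , p
  ... | no _  = let i , p = count-witness (P? ∘ suc) pos in suc i , p

  count-pos : ∀ {n} {P : Fin n → Set} → (P? : Decidable P) → ∀ i → P i → 0 < count P?
  count-pos {suc n} P? zero    p with P? zero
  ... | yes _  = s≤s z≤n
  ... | no ¬p = contradiction p ¬p
  count-pos {suc n} P? (suc i) p =
    ≤-trans (count-pos (P? ∘ suc) i p) (m≤n+m _ (if does (P? zero) then 1 else 0))

  count-≤1 : ∀ {n} {P : Fin n → Set} → (P? : Decidable P) → (∀ i j → P i → P j → i ≡ j) → count P? ≤ 1
  count-≤1 {zero}  P? unique = z≤n
  count-≤1 {suc n} P? unique with P? zero
  ... | yes p = ≤-reflexive (cong suc (count-none (P? ∘ suc) (λ i q → Finₚ.0≢1+n (unique zero (suc i) p q))))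
  ... | no _  = count-≤1 (P? ∘ suc) (λ i j p q → Finₚ.suc-injective (unique (suc i) (suc j) p q))

  count-mono : ∀ {n} {P Q : Fin n → Set} (P? : Decidable P) (Q? : Decidable Q) →
               (∀ i → P i → Q i) → count P? ≤ count Q?
  count-mono {zero}  P? Q? P⊆Q = z≤n
  count-mono {suc n} P? Q? P⊆Q with P? zero | Q? zero | count-mono (P? ∘ suc) (Q? ∘ suc) (P⊆Q ∘ suc)
  ... | yes p | no ¬q | _  = contradiction (P⊆Q zero p) ¬q
  ... | yes _ | yes _ | le = s≤s le
  ... | no _  | yes _ | le = m≤n⇒m≤1+n le
  ... | no _  | no _  | le = le

  count-strict : ∀ {n} {P Q : Fin n → Set} → (P? : Decidable P) (Q? : Decidable Q) → (∀ i → P i → Q i) →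
                 ∀ j → Q j → ¬ P j → count P? < count Q?
  count-strict {suc n} P? Q? P⊆Q zero    q ¬p with P? zero | Q? zero
  ... | yes p | _     = contradiction p ¬p
  ... | no _  | yes _ = s≤s (count-mono (P? ∘ suc) (Q? ∘ suc) (P⊆Q ∘ suc))
  ... | no _  | no ¬q = contradiction q ¬q
  count-strict {suc n} P? Q? P⊆Q (suc j) q ¬p
    with P? zero | Q? zero | count-strict (P? ∘ suc) (Q? ∘ suc) (P⊆Q ∘ suc) j q ¬p
  ... | yes p | no ¬q | _  = contradiction (P⊆Q zero p) ¬q
  ... | yes _ | yes _ | lt = s≤s lt
  ... | no _  | yes _ | lt = m<n⇒m<1+n lt
  ... | no _  | no _  | lt = lt

  count-disjoint-⊎ : ∀ {n} {P Q : Fin n → Set} → (P? : Decidable P) (Q? : Decidable Q) → (∀ i → P i → ¬ Q i) →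
                     count (λ i → P? i ⊎-dec Q? i) ≡ count P? + count Q?
  count-disjoint-⊎ P? Q? disjoint =
    trans (count-split (λ i → P? i ⊎-dec Q? i) P?)
          (cong₂ _+_ (count-cong (λ i → (P? i ⊎-dec Q? i) ×-dec P? i) P? (λ i → mk⇔ proj₂ (λ p → inj₁ p , p)))
                     (count-cong (λ i → (P? i ⊎-dec Q? i) ×-dec ¬? (P? i)) Q?
                                 (λ i → mk⇔ only-Q (λ q → inj₂ q , λ p → disjoint i p q))))
    where
    only-Q : ∀ {A B : Set} → (A ⊎ B) × ¬ A → B
    only-Q (inj₁ p , ¬p) = contradiction p ¬p
    only-Q (inj₂ q , _)  = q

  count-permute : ∀ {n} {P : Fin n → Set} (P? : Decidable P) (π : Permutation′ n) →
                  count (P? ∘ (π ⟨$⟩ʳ_)) ≡ count P?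
  count-permute P? π = begin
    count (P? ∘ (π ⟨$⟩ʳ_))                               ≡⟨ count≡sum (P? ∘ (π ⟨$⟩ʳ_)) ⟩
    Sum.sum (λ i → if does (P? (π ⟨$⟩ʳ i)) then 1 else 0)  ≡⟨ Sum.sum-permute _ π ⟨
    Sum.sum (λ i → if does (P? i) then 1 else 0)            ≡⟨ count≡sum P? ⟨
    count P?                                             ∎
    where
    open ≡-Reasoning
    count≡sum : ∀ {n} {P : Fin n → Set} (P? : Decidable P) → count P? ≡ Sum.sum (λ i → if does (P? i) then 1 else 0)
    count≡sum {zero}  P? = refl
    count≡sum {suc n} P? = cong (_ +_) (count≡sum (P? ∘ suc))

  count-complement : ∀ {n} {P : Fin n → Set} (P? : Decidable P) → count P? + count (¬? ∘ P?) ≡ n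
  count-complement {zero}  P? = refl
  count-complement {suc n} P? with P? zero
  ... | yes _ = cong suc (count-complement (P? ∘ suc))
  ... | no _  = trans (+-suc _ _) (cong suc (count-complement (P? ∘ suc)))

module InjectionOnto {n} (s : Fin n → ℕ) (s-injective : ∀ i j → s i ≡ s j → i ≡ j)
                     (s-range : ∀ i → 1 ≤ s i × s i ≤ n) where

  count-between : ∀ a d → count (λ i → a <? s i ×-dec s i ≤? a + d) ≤ d
  count-between a zero = ≤-reflexive (count-none _ λ i (a<s , s≤a+0) →
    <⇒≱ a<s (≤-trans s≤a+0 (≤-reflexive (+-identityʳ a))))
  count-between a (suc d) = begin
    count (λ i → a <? s i ×-dec s i ≤? a + suc d)
      ≡⟨ count-split _ (λ i → s i ≤? a + d) ⟩
    count (λ i → (a <? s i ×-dec s i ≤? a + suc d) ×-dec s i ≤? a + d)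
      + count (λ i → (a <? s i ×-dec s i ≤? a + suc d) ×-dec ¬? (s i ≤? a + d))
      ≤⟨ +-mono-≤ (≤-reflexive lower) (count-≤1 _ top-unique) ⟩
    count (λ i → a <? s i ×-dec s i ≤? a + d) + 1
      ≤⟨ +-monoˡ-≤ 1 (count-between a d) ⟩
    d + 1
      ≡⟨ +-comm d 1 ⟩
    suc d ∎
    where
    open ≤-Reasoning
    lower = count-cong _ (λ i → a <? s i ×-dec s i ≤? a + d) λ i →
      mk⇔ (λ ((a<s , _) , s≤a+d) → a<s , s≤a+d)
          (λ (a<s , s≤a+d) → (a<s , ≤-trans s≤a+d (+-monoʳ-≤ a (n≤1+n d))) , s≤a+d)
    top : ∀ {i} → (a < s i × s i ≤ a + suc d) × ¬ s i ≤ a + d → s i ≡ a + suc d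
    top ((_ , s≤) , s≰) = ≤-antisym s≤ (≤-trans (≤-reflexive (+-suc a d)) (≰⇒> s≰))
    top-unique : ∀ i j → _ → _ → i ≡ j
    top-unique i j p q = s-injective i j (trans (top p) (sym (top q)))

  -- At most t values lie in [1, t] and at most n ∸ t in (t, n], while all n values lie in one of them.
  count-≤ : ∀ t → t ≤ n → count (λ i → s i ≤? t) ≡ t
  count-≤ t t≤n = ≤-antisym A≤t t≤A
    where
    A = count (λ i → s i ≤? t)
    B = count (¬? ∘ (λ i → s i ≤? t))
    A≤t : A ≤ t
    A≤t = ≤-trans (≤-reflexive (count-cong _ _ λ i → mk⇔ (λ s≤t → proj₁ (s-range i) , s≤t) proj₂))
                  (count-between 0 t)
    B≤n∸t : B ≤ n ∸ t
    B≤n∸t = ≤-trans (≤-reflexive (count-cong _ _ λ i →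
                       mk⇔ (λ s≰t → ≰⇒> s≰t , ≤-trans (proj₂ (s-range i)) (≤-reflexive (sym (m+[n∸m]≡n t≤n))))
                           (λ (t<s , _) → <⇒≱ t<s)))
                    (count-between t (n ∸ t))
    t≤A : t ≤ A
    t≤A = begin
      t            ≡⟨ m∸[m∸n]≡n t≤n ⟨
      n ∸ (n ∸ t)  ≤⟨ ∸-monoʳ-≤ n B≤n∸t ⟩
      n ∸ B        ≡⟨ cong (_∸ B) (count-complement (λ i → s i ≤? t)) ⟨
      (A + B) ∸ B  ≡⟨ m+n∸n≡m A B ⟩
      A            ∎
      where open ≤-Reasoning

  count-interval : ∀ p b → p ≤ b → b ≤ n → count (λ i → p <? s i ×-dec s i ≤? b) ≡ b ∸ p
  count-interval p b p≤b b≤n = +-cancelˡ-≡ p _ _ (begin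
    p + count (λ i → p <? s i ×-dec s i ≤? b)
      ≡⟨ cong₂ _+_ (sym (count-≤ p (≤-trans p≤b b≤n))) (sym upper) ⟩
    count (λ i → s i ≤? p) + count (λ i → s i ≤? b ×-dec ¬? (s i ≤? p))
      ≡⟨ cong (_+ count (λ i → s i ≤? b ×-dec ¬? (s i ≤? p))) lower ⟨
    count (λ i → s i ≤? b ×-dec s i ≤? p) + count (λ i → s i ≤? b ×-dec ¬? (s i ≤? p))
      ≡⟨ count-split (λ i → s i ≤? b) (λ i → s i ≤? p) ⟨
    count (λ i → s i ≤? b)
      ≡⟨ count-≤ b b≤n ⟩
    b
      ≡⟨ m+[n∸m]≡n p≤b ⟨
    p + (b ∸ p) ∎)
    where
    open ≡-Reasoning
    lower = count-cong _ (λ i → s i ≤? p) λ i → mk⇔ proj₂ (λ s≤p → ≤-trans s≤p p≤b , s≤p)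
    upper = count-cong _ (λ i → p <? s i ×-dec s i ≤? b) λ i →
              mk⇔ (λ (s≤b , s≰p) → ≰⇒> s≰p , s≤b) (λ (p<s , s≤b) → s≤b , <⇒≱ p<s)

  onto : ∀ t → t < n → ∃[ i ] s i ≡ suc t
  onto t t<n =
    let i , t<s , s≤1+t = count-witness (λ i → t <? s i ×-dec s i ≤? suc t)
                                        (≤-reflexive (sym (trans (count-interval t (suc t) (n≤1+n t) t<n) (m+n∸n≡m 1 t))))
    in i , ≤-antisym s≤1+t t<s

-- Parking

firstFree-≥ : ∀ f occ a → a ≤ firstFree f occ a
firstFree-≥ zero    occ a = ≤-refl
firstFree-≥ (suc f) occ a with a ∈? occ
... | yes _ = <⇒≤ (firstFree-≥ f occ (suc a))
... | no _  = ≤-refl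

firstFree-free : ∀ f occ a → a ∉ occ → firstFree f occ a ≡ a
firstFree-free zero    occ a a∉ = refl
firstFree-free (suc f) occ a a∉ with a ∈? occ
... | yes a∈ = contradiction a∈ a∉
... | no _   = refl

firstFree-taken : ∀ f occ a → a ∈ occ → firstFree (suc f) occ a ≡ firstFree f occ (suc a)
firstFree-taken f occ a a∈ with a ∈? occ
... | yes _  = refl
... | no a∉ = contradiction a∈ a∉

firstFree-≤suc : ∀ f occ a → length occ ≡ f → firstFree f occ a ≤ suc a →
                 firstFree f occ a ∉ occ × (firstFree f occ a ≢ a → a ∈ occ)
firstFree-≤suc zero [] a _ _ = (λ ()) , λ p≢a → contradiction refl p≢a
firstFree-≤suc (suc f) occ a len p≤1+a with a ∈? occ
... | no a∉ = a∉ , λ p≢a → contradiction refl p≢a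
... | yes a∈ with suc a ∈? occ
...   | no 1+a∉ = subst (_∉ occ) (sym (firstFree-free f occ (suc a) 1+a∉)) 1+a∉ , λ _ → a∈
...   | yes 1+a∈ = ⊥-elim (two-taken f occ len a∈ 1+a∈ p≤1+a)
  where
  two-taken : ∀ f occ → length occ ≡ suc f → a ∈ occ → suc a ∈ occ → ¬ firstFree f occ (suc a) ≤ suc a
  two-taken zero    (_ ∷ []) _ (here a≡x) (here 1+a≡x) _ = 1+n≢n (trans 1+a≡x (sym a≡x))
  two-taken (suc f) occ      _ _ 1+a∈ p≤1+a =
    <⇒≱ (≤-trans (firstFree-≥ f occ (2 + a)) (≤-reflexive (sym (firstFree-taken f occ (suc a) 1+a∈)))) p≤1+a

firstFree-next : ∀ f occ x → 0 < f → x ∈ occ → suc x ∉ occ → firstFree f occ x ≡ suc x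
firstFree-next (suc f) occ x _ x∈ 1+x∉ = trans (firstFree-taken f occ x x∈) (firstFree-free f occ (suc x) 1+x∉)

OccupiedBefore : ∀ {m} → List ℕ → Vec ℕ m → Fin m → ℕ → Set
OccupiedBefore occ₀ as i x = x ∈ occ₀ ⊎ ∃[ j ] (toℕ j < toℕ i × lookup (parkGo occ₀ as) j ≡ x)

parkGo-lookup : ∀ {m} occ₀ (as : Vec ℕ m) i →
  ∃[ occ ] (length occ ≡ length occ₀ + toℕ i × (∀ x → x ∈ occ ⇔ OccupiedBefore occ₀ as i x)
            × lookup (parkGo occ₀ as) i ≡ firstFree (length occ) occ (lookup as i))
parkGo-lookup occ₀ (a ∷ as) zero = occ₀ , sym (+-identityʳ _) , (λ x → mk⇔ inj₁ initial) , refl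
  where
  initial : ∀ {x} → OccupiedBefore occ₀ (a ∷ as) zero x → x ∈ occ₀
  initial (inj₁ x∈) = x∈
parkGo-lookup occ₀ (a ∷ as) (suc i) =
  let occ , len , occ⇔ , eq = parkGo-lookup (p ∷ occ₀) as i
  in occ , trans len (sym (+-suc _ _)) ,
     (λ x → mk⇔ (shift ∘ Equivalence.to (occ⇔ x)) (Equivalence.from (occ⇔ x) ∘ unshift)) , eq
  where
  p = firstFree (length occ₀) occ₀ a
  shift : ∀ {x} → OccupiedBefore (p ∷ occ₀) as i x → OccupiedBefore occ₀ (a ∷ as) (suc i) x
  shift (inj₁ (here x≡p))         = inj₂ (zero , s≤s z≤n , sym x≡p)
  shift (inj₁ (there x∈))         = inj₁ x∈
  shift (inj₂ (j , j<i , spot≡x)) = inj₂ (suc j , s≤s j<i , spot≡x)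
  unshift : ∀ {x} → OccupiedBefore occ₀ (a ∷ as) (suc i) x → OccupiedBefore (p ∷ occ₀) as i x
  unshift (inj₁ x∈)                     = inj₁ (there x∈)
  unshift (inj₂ (zero , _ , p≡x))       = inj₁ (here (sym p≡x))
  unshift (inj₂ (suc j , s≤s j<i , eq)) = inj₂ (j , j<i , eq)

module UnitInterval {n} (β : Vec ℕ n) (β-ui : IsUnitInterval n β) where

  a s : Fin n → ℕ
  a i = lookup β i
  s i = lookup (spots β) i

  a-range : ∀ i → 1 ≤ a i × a i ≤ n
  a-range = proj₁ (proj₁ β-ui)

  s≤1+a : ∀ i → s i ≤ suc (a i)
  s≤1+a = proj₂ β-ui

  private
    arrival : ∀ i → ∃[ occ ] ((∀ x → x ∈ occ ⇔ OccupiedBefore [] β i x) × s i ≡ firstFree (length occ) occ (a i)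
                             × s i ∉ occ × (s i ≢ a i → a i ∈ occ))
    arrival i =
      let occ , _ , occ⇔ , s≡ = parkGo-lookup [] β i
          free , moved = firstFree-≤suc (length occ) occ (a i) refl (subst (_≤ suc (a i)) s≡ (s≤1+a i))
      in occ , occ⇔ , s≡ , subst (_∉ occ) (sym s≡) free , moved ∘ subst (_≢ a i) s≡

  a≤s : ∀ i → a i ≤ s i
  a≤s i = let occ , _ , s≡ , _ = arrival i in subst (a i ≤_) (sym s≡) (firstFree-≥ (length occ) occ (a i))

  s-range : ∀ i → 1 ≤ s i × s i ≤ n
  s-range i = ≤-trans (proj₁ (a-range i)) (a≤s i) , proj₂ (proj₁ β-ui) i

  -- Car i is lucky when it parks in its preferred spot, a i ≡ s i.
  lucky-or-next : ∀ i → a i ≡ s i ⊎ suc (a i) ≡ s i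
  lucky-or-next i with a i ≟ s i
  ... | yes a≡s = inj₁ a≡s
  ... | no a≢s  = inj₂ (≤-antisym (≤∧≢⇒< (a≤s i) a≢s) (s≤1+a i))

  s-fresh : ∀ i j → toℕ i < toℕ j → s i ≢ s j
  s-fresh i j i<j s≡ = let occ , occ⇔ , _ , free , _ = arrival j
                       in free (Equivalence.from (occ⇔ (s j)) (inj₂ (i , i<j , s≡)))

  s-injective : ∀ i j → s i ≡ s j → i ≡ j
  s-injective i j s≡ with <-cmp (toℕ i) (toℕ j)
  ... | tri< i<j _ _ = contradiction s≡ (s-fresh i j i<j)
  ... | tri≈ _ i≡j _ = Finₚ.toℕ-injective i≡j
  ... | tri> _ _ j<i = contradiction (sym s≡) (s-fresh j i j<i)

  a-taken-earlier : ∀ i → a i ≢ s i → ∃[ j ] (toℕ j < toℕ i × s j ≡ a i)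
  a-taken-earlier i a≢s with arrival i
  ... | occ , occ⇔ , _ , _ , moved with Equivalence.to (occ⇔ (a i)) (moved (a≢s ∘ sym))
  ...   | inj₂ earlier = earlier

-- Words and their standardization

module Word {n} (u : Fin n → ℕ) where

  infix 4 _≺_ _≺?_

  _≺_ : Fin n → Fin n → Set
  j ≺ i = u j < u i ⊎ (u j ≡ u i × toℕ j < toℕ i)

  _≺?_ : ∀ j i → Dec (j ≺ i)
  j ≺? i = u j <? u i ⊎-dec (u j ≟ u i ×-dec toℕ j <? toℕ i)

  below earlier rank : Fin n → ℕ
  below   i = count (λ j → u j <? u i)
  earlier i = count (λ j → u j ≟ u i ×-dec toℕ j <? toℕ i)
  rank    i = count (_≺? i)

  rank≡below+earlier : ∀ i → rank i ≡ below i + earlier i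
  rank≡below+earlier i = count-disjoint-⊎ (λ j → u j <? u i) (λ j → u j ≟ u i ×-dec toℕ j <? toℕ i)
                                          (λ j uj<ui (uj≡ui , _) → <⇒≢ uj<ui uj≡ui)

  ≺-irrefl : ∀ i → ¬ i ≺ i
  ≺-irrefl i (inj₁ ui<ui)      = <-irrefl refl ui<ui
  ≺-irrefl i (inj₂ (_ , i<i)) = <-irrefl refl i<i

  ≺-trans : ∀ {i j k} → i ≺ j → j ≺ k → i ≺ k
  ≺-trans (inj₁ p)       (inj₁ q)       = inj₁ (<-trans p q)
  ≺-trans (inj₁ p)       (inj₂ (q , _)) = inj₁ (<-≤-trans p (≤-reflexive q))
  ≺-trans (inj₂ (p , _)) (inj₁ q)       = inj₁ (≤-<-trans (≤-reflexive p) q)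
  ≺-trans (inj₂ (p , p′)) (inj₂ (q , q′)) = inj₂ (trans p q , <-trans p′ q′)

  ≺-total : ∀ i j → i ≢ j → i ≺ j ⊎ j ≺ i
  ≺-total i j i≢j with <-cmp (u i) (u j) | <-cmp (toℕ i) (toℕ j)
  ... | tri< ui<uj _ _ | _            = inj₁ (inj₁ ui<uj)
  ... | tri> _ _ uj<ui | _            = inj₂ (inj₁ uj<ui)
  ... | tri≈ _ ui≡uj _ | tri< i<j _ _ = inj₁ (inj₂ (ui≡uj , i<j))
  ... | tri≈ _ _ _     | tri≈ _ i≡j _ = contradiction (Finₚ.toℕ-injective i≡j) i≢j
  ... | tri≈ _ ui≡uj _ | tri> _ _ j<i = inj₂ (inj₂ (sym ui≡uj , j<i))

  rank-mono : ∀ {j i} → j ≺ i → rank j < rank i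
  rank-mono {j} {i} j≺i = count-strict (_≺? j) (_≺? i) (λ k k≺j → ≺-trans k≺j j≺i) j j≺i (≺-irrefl j)

  rank<n : ∀ i → rank i < n
  rank<n i = subst (rank i <_) (count-all (λ _ → yes tt) (λ _ → tt))
                   (count-strict (_≺? i) (λ _ → yes tt) (λ _ _ → tt) i tt (≺-irrefl i))

  rank-<⇒≺ : ∀ {i j} → rank i < rank j → i ≺ j
  rank-<⇒≺ {i} {j} ri<rj with ≺-total i j (λ { refl → <-irrefl refl ri<rj })
  ... | inj₁ i≺j = i≺j
  ... | inj₂ j≺i = contradiction (rank-mono j≺i) (<⇒≯ ri<rj)

  rank-injective : ∀ i j → rank i ≡ rank j → i ≡ j
  rank-injective i j r≡ with i Finₚ.≟ j
  ... | yes i≡j = i≡j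
  ... | no i≢j with ≺-total i j i≢j
  ...   | inj₁ i≺j = contradiction r≡ (<⇒≢ (rank-mono i≺j))
  ...   | inj₂ j≺i = contradiction (sym r≡) (<⇒≢ (rank-mono j≺i))

  rank-onto : ∀ r → r < n → ∃[ j ] rank j ≡ r
  rank-onto r r<n = let j , eq = InjectionOnto.onto (suc ∘ rank) (λ i j → rank-injective i j ∘ suc-injective)
                                                    (λ i → s≤s z≤n , rank<n i) r r<n
                    in j , suc-injective eq

  below-cong : ∀ {i j} → u i ≡ u j → below i ≡ below j
  below-cong {i} {j} ui≡uj = count-cong _ (λ k → u k <? u j) λ k →
    mk⇔ (subst (u k <_) ui≡uj) (subst (u k <_) (sym ui≡uj))

  rank<below : ∀ {i j} → u j < u i → rank j < below i
  rank<below {i} {j} uj<ui =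
    count-strict (_≺? j) (λ k → u k <? u i) (λ k k≺j → ≤-<-trans (≺⇒≤ k≺j) uj<ui) j uj<ui (≺-irrefl j)
    where
    ≺⇒≤ : ∀ {k} → k ≺ j → u k ≤ u j
    ≺⇒≤ (inj₁ uk<uj)      = <⇒≤ uk<uj
    ≺⇒≤ (inj₂ (uk≡uj , _)) = ≤-reflexive uk≡uj

  below≤rank : ∀ i → below i ≤ rank i
  below≤rank i = ≤-trans (m≤m+n _ _) (≤-reflexive (sym (rank≡below+earlier i)))

  same-letter : ∀ {i j} → below i ≤ rank j → rank j ≤ rank i → u j ≡ u i
  same-letter {i} {j} bi≤rj rj≤ri with <-cmp (u j) (u i)
  ... | tri< uj<ui _ _ = contradiction bi≤rj (<⇒≱ (rank<below uj<ui))
  ... | tri≈ _ uj≡ui _ = uj≡ui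
  ... | tri> _ _ ui<uj = contradiction rj≤ri (<⇒≱ (<-≤-trans (rank<below ui<uj) (below≤rank j)))

  ≤-rank⇒≤ : ∀ {i j} → rank j ≤ rank i → u j ≤ u i
  ≤-rank⇒≤ rj≤ri = ≮⇒≥ λ ui<uj → <⇒≱ (rank-mono (inj₁ ui<uj)) rj≤ri

  rank-<-below⇒< : ∀ {i j} → rank i < below j → u i < u j
  rank-<-below⇒< {i} {j} ri<bj = ≰⇒> λ uj≤ui → <⇒≱ ri<bj (≤-trans (below-mono uj≤ui) (below≤rank i))
    where
    below-mono : ∀ {i j} → u j ≤ u i → below j ≤ below i
    below-mono {i} {j} uj≤ui = count-mono (λ k → u k <? u j) (λ k → u k <? u i) λ k uk<uj → <-≤-trans uk<uj uj≤ui

  first-occurrence : ∀ i → ∃[ j ] (u j ≡ u i × earlier j ≡ 0 × rank j ≡ below i)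
  first-occurrence i =
    let j , rj≡ = rank-onto (below i) (≤-<-trans (below≤rank i) (rank<n i))
        uj≡ui = same-letter (≤-reflexive (sym rj≡)) (subst (_≤ rank i) (sym rj≡) (below≤rank i))
        ej≡0 = +-cancelˡ-≡ (below j) _ 0 (begin
          below j + earlier j  ≡⟨ rank≡below+earlier j ⟨
          rank j               ≡⟨ rj≡ ⟩
          below i              ≡⟨ below-cong uj≡ui ⟨
          below j              ≡⟨ +-identityʳ _ ⟨
          below j + 0          ∎)
    in j , uj≡ui , ej≡0 , rj≡
    where open ≡-Reasoning

  rank-first : ∀ i → earlier i ≡ 0 → rank i ≡ below i
  rank-first i e≡0 = trans (rank≡below+earlier i) (trans (cong (below i +_) e≡0) (+-identityʳ _))

  -- The preference of car i in the labelling unit-interval parking function: the spot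
  -- 1 + rank i for the first occurrence of a letter, one spot earlier for the others.
  label : Fin n → ℕ
  label i = suc (below i + pred (earlier i))

  label-first : ∀ i → earlier i ≡ 0 → label i ≡ suc (rank i)
  label-first i e≡0 = cong suc (trans (cong (λ e → below i + pred e) e≡0) (trans (+-identityʳ _) (sym (rank-first i e≡0))))

  label-later : ∀ i → 0 < earlier i → label i ≡ rank i
  label-later i e>0 = begin
    suc (below i + pred (earlier i))  ≡⟨ +-suc (below i) _ ⟨
    below i + suc (pred (earlier i))  ≡⟨ cong (below i +_) (suc-pred (earlier i) {{>-nonZero e>0}}) ⟩
    below i + earlier i               ≡⟨ rank≡below+earlier i ⟨
    rank i                            ∎
    where open ≡-Reasoning

  label-bounds : ∀ i → rank i ≤ label i × label i ≤ suc (rank i)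
  label-bounds i with earlier i ≟ 0
  ... | yes e≡0 = let l≡ = label-first i e≡0
                  in ≤-trans (n≤1+n _) (≤-reflexive (sym l≡)) , ≤-reflexive l≡
  ... | no e≢0  = let l≡ = label-later i (n≢0⇒n>0 e≢0)
                  in ≤-reflexive (sym l≡) , ≤-trans (≤-reflexive l≡) (n≤1+n _)

labelOf : ∀ {n} → (Fin n → ℕ) → Vec ℕ n
labelOf u = tabulate (Word.label u)

SameOrder : ∀ {n} → (Fin n → ℕ) → (Fin n → ℕ) → Set
SameOrder u u′ = ∀ i j → u i < u j ⇔ u′ i < u′ j

SameOrder-sym : ∀ {n} {u u′ : Fin n → ℕ} → SameOrder u u′ → SameOrder u′ u
SameOrder-sym same i j = ⇔.sym (same i j)

SameOrder-≡ : ∀ {n} {u u′ : Fin n → ℕ} → SameOrder u u′ → ∀ i j → u i ≡ u j → u′ i ≡ u′ j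
SameOrder-≡ {u′ = u′} same i j ui≡uj with <-cmp (u′ i) (u′ j)
... | tri< u′i<u′j _ _ = contradiction ui≡uj (<⇒≢ (Equivalence.from (same i j) u′i<u′j))
... | tri≈ _ u′i≡u′j _ = u′i≡u′j
... | tri> _ _ u′j<u′i = contradiction (sym ui≡uj) (<⇒≢ (Equivalence.from (same j i) u′j<u′i))

labelOf-cong : ∀ {n} {u u′ : Fin n → ℕ} → SameOrder u u′ → labelOf u ≡ labelOf u′
labelOf-cong {u′ = u′} same = tabulate-cong λ i → cong₂ (λ b e → suc (b + pred e))
  (count-cong _ (λ j → u′ j <? u′ i) λ j → same j i)
  (count-cong _ (λ j → u′ j ≟ u′ i ×-dec toℕ j <? toℕ i) λ j →
    mk⇔ (λ (uj≡ui , j<i) → SameOrder-≡ same j i uj≡ui , j<i)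
        (λ (u′j≡u′i , j<i) → SameOrder-≡ (SameOrder-sym same) j i u′j≡u′i , j<i))

SameOrder-trans : ∀ {n} {u u′ u″ : Fin n → ℕ} → SameOrder u u′ → SameOrder u′ u″ → SameOrder u u″
SameOrder-trans same same′ i j = ⇔.trans (same i j) (same′ i j)

≗⇒SameOrder : ∀ {n} {u u′ : Fin n → ℕ} → (∀ i → u i ≡ u′ i) → SameOrder u u′
≗⇒SameOrder u≗u′ i j = mk⇔ (subst₂ _<_ (u≗u′ i) (u≗u′ j)) (subst₂ _<_ (sym (u≗u′ i)) (sym (u≗u′ j)))

Gapless : ∀ {n} → (Fin n → ℕ) → Set
Gapless u = ∀ i m → m < u i → ∃[ j ] u j ≡ m

SameOrder⇒≗ : ∀ {n} {u u′ : Fin n → ℕ} → Gapless u → Gapless u′ → SameOrder u u′ → ∀ i → u i ≡ u′ i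
SameOrder⇒≗ {u = u} {u′} gapless gapless′ same i =
  sym (<-rec (λ k → ∀ i → u i ≡ k → u′ i ≡ k) step (u i) i refl)
  where
  step : ∀ k → (∀ {k′} → k′ < k → ∀ i → u i ≡ k′ → u′ i ≡ k′) → ∀ i → u i ≡ k → u′ i ≡ k
  step k IH i refl with <-cmp (u′ i) (u i)
  ... | tri≈ _ u′i≡ui _ = u′i≡ui
  ... | tri< u′i<ui _ _ =
    let j , uj≡u′i = gapless i (u′ i) u′i<ui
    in contradiction (trans (IH (subst (_< u i) (sym uj≡u′i) u′i<ui) j refl) uj≡u′i)
                     (<⇒≢ (Equivalence.to (same j i) (subst (_< u i) (sym uj≡u′i) u′i<ui)))
  ... | tri> _ _ ui<u′i =
    let j , u′j≡ui = gapless′ i (u i) ui<u′i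
        uj<ui = Equivalence.from (same j i) (subst (_< u′ i) (sym u′j≡ui) ui<u′i)
    in contradiction (trans (sym u′j≡ui) (IH uj<ui j refl)) (<⇒≢ uj<ui ∘ sym)

-- Breakpoints and blocks

module _ {A : Set} {P Q : A → Set} (P? : Decidable P) (Q? : Decidable Q) where

  length-filter-mono : (∀ {b} → P b → Q b) → ∀ L → length (List.filter P? L) ≤ length (List.filter Q? L)
  length-filter-mono P⊆Q []      = z≤n
  length-filter-mono P⊆Q (b ∷ L) with P? b | Q? b | length-filter-mono P⊆Q L
  ... | yes p | no ¬q | _  = contradiction (P⊆Q p) ¬q
  ... | yes _ | yes _ | le = s≤s le
  ... | no _  | yes _ | le = m≤n⇒m≤1+n le
  ... | no _  | no _  | le = le

  length-filter-strict : (∀ {b} → P b → Q b) → ∀ {b L} → b ∈ L → ¬ P b → Q b →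
                         length (List.filter P? L) < length (List.filter Q? L)
  length-filter-strict P⊆Q {L = c ∷ L} (here refl) ¬p q with P? c | Q? c
  ... | yes p | _     = contradiction p ¬p
  ... | no _  | yes _ = s≤s (length-filter-mono P⊆Q L)
  ... | no _  | no ¬q = contradiction q ¬q
  length-filter-strict P⊆Q {L = c ∷ L} (there b∈) ¬p q with P? c | Q? c | length-filter-strict P⊆Q b∈ ¬p q
  ... | yes p | no ¬q | _  = contradiction (P⊆Q p) ¬q
  ... | yes _ | yes _ | lt = s≤s lt
  ... | no _  | yes _ | lt = m<n⇒m<1+n lt
  ... | no _  | no _  | lt = lt

  length-filter-<⁻¹ : ∀ L → length (List.filter P? L) < length (List.filter Q? L) → ∃[ b ] (b ∈ L × ¬ P b × Q b)
  length-filter-<⁻¹ (b ∷ L) lt with P? b | Q? b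
  ... | no ¬p | yes q = b , here refl , ¬p , q
  ... | yes _ | yes _ = map₂ (map₁ there) (length-filter-<⁻¹ L (≤-pred lt))
  ... | no _  | no _  = map₂ (map₁ there) (length-filter-<⁻¹ L lt)
  ... | yes _ | no _  = map₂ (map₁ there) (length-filter-<⁻¹ L (<-trans (n<1+n _) lt))

opaque
  unfolding count

  length-filter≡count : ∀ {m} {P : ℕ → Set} (P? : Decidable P) (v : Vec ℕ m) →
                        length (List.filter P? (toList v)) ≡ count (P? ∘ lookup v)
  length-filter≡count P? []      = refl
  length-filter≡count P? (x ∷ v) with P? x
  ... | yes _ = cong suc (length-filter≡count P? v)
  ... | no _  = length-filter≡count P? v

countBelow : List ℕ → ℕ → ℕ
countBelow L x = length (List.filter (_<? x) L)

countBelow-< : ∀ L {x y b} → b ∈ L → x ≤ b → b < y → countBelow L x < countBelow L y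
countBelow-< L {x} {y} b∈ x≤b b<y =
  length-filter-strict (_<? x) (_<? y) (λ c<x → <-trans c<x (≤-<-trans x≤b b<y)) b∈ (≤⇒≯ x≤b) b<y

countBelow-<⁻¹ : ∀ L {x y} → countBelow L x < countBelow L y → ∃[ b ] (b ∈ L × x ≤ b × b < y)
countBelow-<⁻¹ L {x} {y} lt = map₂ (map₂ (map₁ ≮⇒≥)) (length-filter-<⁻¹ (_<? x) (_<? y) L lt)

countBelow-∷-< : ∀ {b x} L → b < x → countBelow (b ∷ L) x ≡ suc (countBelow L x)
countBelow-∷-< {x = x} L b<x = cong length (Listₚ.filter-accept (_<? x) b<x)

countBelow-pos : ∀ L {x b} → b ∈ L → b < x → 0 < countBelow L x
countBelow-pos L b∈ b<x = ≤-<-trans z≤n (countBelow-< L b∈ z≤n b<x)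

countBelow-≡0 : ∀ L {x} → (∀ {b} → b ∈ L → x ≤ b) → countBelow L x ≡ 0
countBelow-≡0 L {x} x≤ = cong length (Listₚ.filter-none (_<? x) (All.tabulate (≤⇒≯ ∘ x≤)))

-- Entries past the end of the list read as 0 (a letter that does not occur).
nth : List ℕ → ℕ → ℕ
nth []       _       = 0
nth (x ∷ _)  zero    = x
nth (_ ∷ xs) (suc m) = nth xs m

Chain : ℕ → ℕ → List ℕ → Set
Chain N p []      = p ≡ N
Chain N p (b ∷ L) = p < b × Chain N b L

module _ {N : ℕ} where

  chain-< : ∀ {p L} → Chain N p L → ∀ {x} → x ∈ L → p < x
  chain-< (p<b , _)  (here refl) = p<b
  chain-< (p<b , ch) (there x∈)  = <-trans p<b (chain-< ch x∈)

  chain-≥ : ∀ {b L x} → Chain N b L → x ≤ b → ∀ {c} → c ∈ b ∷ L → x ≤ c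
  chain-≥ ch x≤b (here refl) = x≤b
  chain-≥ ch x≤b (there c∈)  = ≤-trans x≤b (<⇒≤ (chain-< ch c∈))

  chain-≤ : ∀ {p} L → Chain N p L → p ≤ N
  chain-≤ []      refl       = ≤-refl
  chain-≤ (b ∷ L) (p<b , ch) = <⇒≤ (<-≤-trans p<b (chain-≤ L ch))

  chain-sum : ∀ {p} L → Chain N p L → sum (diffs p L) ≡ N ∸ p
  chain-sum         []      refl       = sym (n∸n≡0 N)
  chain-sum {p = p} (b ∷ L) (p<b , ch) = begin
    (b ∸ p) + sum (diffs b L)  ≡⟨ cong ((b ∸ p) +_) (chain-sum L ch) ⟩
    (b ∸ p) + (N ∸ b)          ≡⟨ +-comm (b ∸ p) (N ∸ b) ⟩
    (N ∸ b) + (b ∸ p)          ≡⟨ +-∸-assoc (N ∸ b) (<⇒≤ p<b) ⟨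
    ((N ∸ b) + b) ∸ p          ≡⟨ cong (_∸ p) (m∸n+n≡m (chain-≤ L ch)) ⟩
    N ∸ p                      ∎
    where open ≡-Reasoning

  chain-diffs-pos : ∀ {p} L → Chain N p L → ∀ m → m < length (diffs p L) → 0 < nth (diffs p L) m
  chain-diffs-pos (b ∷ L) (p<b , _)  zero    _         = m<n⇒0<n∸m p<b
  chain-diffs-pos (b ∷ L) (_ , ch)   (suc m) (s≤s m<ℓ) = chain-diffs-pos L ch m m<ℓ

  filter-upTo-chain : ∀ {P : ℕ → Set} (P? : Decidable P) m (f : ℕ → ℕ) {p} → (∀ x → f x < f (suc x)) →
                      p < f 0 → f m ≡ N → P (f m) → Chain N p (List.filter P? (List.applyUpTo f (suc m)))
  filter-upTo-chain P? zero f f-incr p<f0 fm≡N Pfm with P? (f 0)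
  ... | yes _  = p<f0 , fm≡N
  ... | no ¬p = contradiction Pfm ¬p
  filter-upTo-chain P? (suc m) f f-incr p<f0 fm≡N Pfm with P? (f 0)
  ... | yes _ = p<f0 , filter-upTo-chain P? m (f ∘ suc) (f-incr ∘ suc) (f-incr 0) fm≡N Pfm
  ... | no _  = filter-upTo-chain P? m (f ∘ suc) (f-incr ∘ suc) (<-trans p<f0 (f-incr 0)) fm≡N Pfm

module Blocks {n} (β : Vec ℕ n) (β-ui : IsUnitInterval n β) where

  open UnitInterval β β-ui public
  open InjectionOnto s s-injective s-range public

  w : Fin n → ℕ
  w = blockOf β

  open Word w public

  countLe-split : ∀ b → b ≤ n → countLe b β ≡ b + count (λ i → s i ≟ suc b ×-dec a i ≟ b)
  countLe-split b b≤n = begin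
    countLe b β                     ≡⟨ length-filter≡count (_≤? b) β ⟩
    count (λ i → a i ≤? b)          ≡⟨ count-split (λ i → a i ≤? b) (λ i → s i ≤? b) ⟩
    count (λ i → a i ≤? b ×-dec s i ≤? b) + count (λ i → a i ≤? b ×-dec ¬? (s i ≤? b))
                                    ≡⟨ cong₂ _+_ (trans parked (count-≤ b b≤n)) moved ⟩
    b + count (λ i → s i ≟ suc b ×-dec a i ≟ b) ∎
    where
    open ≡-Reasoning
    parked = count-cong _ (λ i → s i ≤? b) λ i → mk⇔ proj₂ (λ s≤b → ≤-trans (a≤s i) s≤b , s≤b)
    moved = count-cong _ (λ i → s i ≟ suc b ×-dec a i ≟ b) λ i →
      mk⇔ (λ (a≤b , s≰b) → let s≡ = ≤-antisym (≤-trans (s≤1+a i) (s≤s a≤b)) (≰⇒> s≰b)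
                           in s≡ , ≤-antisym a≤b (≤-pred (≤-trans (≤-reflexive (sym s≡)) (s≤1+a i))))
          (λ (s≡ , a≡) → ≤-reflexive a≡ , λ s≤b → 1+n≰n (≤-trans (≤-reflexive (sym s≡)) s≤b))

  breakpoint⇒lucky : ∀ b → b ≤ n → countLe b β ≡ b → ∀ i → s i ≡ suc b → a i ≡ s i
  breakpoint⇒lucky b b≤n bp i s≡ with lucky-or-next i
  ... | inj₁ lucky  = lucky
  ... | inj₂ 1+a≡s = contradiction
    (count-pos (λ i → s i ≟ suc b ×-dec a i ≟ b) i (s≡ , suc-injective (trans 1+a≡s s≡)))
    (≤⇒≯ (≤-reflexive none))
    where
    none : count (λ i → s i ≟ suc b ×-dec a i ≟ b) ≡ 0
    none = +-cancelˡ-≡ b _ 0 (trans (sym (countLe-split b b≤n)) (trans bp (sym (+-identityʳ b))))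

  lucky⇒breakpoint : ∀ b → b ≤ n → (∀ i → s i ≡ suc b → a i ≡ s i) → countLe b β ≡ b
  lucky⇒breakpoint b b≤n lucky = begin
    countLe b β                                  ≡⟨ countLe-split b b≤n ⟩
    b + count (λ i → s i ≟ suc b ×-dec a i ≟ b)  ≡⟨ cong (b +_) (count-none _ λ i (s≡ , a≡) →
                                                     1+n≢n (trans (sym s≡) (trans (sym (lucky i s≡)) a≡))) ⟩
    b + 0                                        ≡⟨ +-identityʳ b ⟩
    b                                            ∎
    where open ≡-Reasoning

  bps : List ℕ
  bps = breakpoints β

  ∈-breakpoints⁻ : ∀ {b} → b ∈ bps → b ≤ n × countLe b β ≡ b
  ∈-breakpoints⁻ b∈ with b∈upTo , bp ← ∈-filter⁻ (λ k → countLe k β ≟ k) {xs = List.applyUpTo suc n} b∈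
                   with _ , b′<n , refl ← ∈-applyUpTo⁻ suc b∈upTo = b′<n , bp

  ∈-breakpoints⁺ : ∀ b → 1 ≤ b → b ≤ n → countLe b β ≡ b → b ∈ bps
  ∈-breakpoints⁺ (suc b) _ b<n bp = ∈-filter⁺ (λ k → countLe k β ≟ k) (∈-applyUpTo⁺ suc b<n) bp

  block-<⇒lucky-between : ∀ i i′ → w i < w i′ → ∃[ j ] (s i < s j × s j ≤ s i′ × a j ≡ s j)
  block-<⇒lucky-between i i′ wi<wi′ =
    let b , b∈ , si≤b , b<si′ = countBelow-<⁻¹ bps wi<wi′
        b≤n , bp = ∈-breakpoints⁻ b∈
        j , sj≡ = onto b (<-≤-trans b<si′ (proj₂ (s-range i′)))
    in j , subst (s i <_) (sym sj≡) (s≤s si≤b) , subst (_≤ s i′) (sym sj≡) b<si′ , breakpoint⇒lucky b b≤n bp j sj≡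

  lucky-between⇒block-< : ∀ i i′ j → s i < s j → s j ≤ s i′ → a j ≡ s j → w i < w i′
  lucky-between⇒block-< i i′ j si<sj sj≤si′ lucky with s j in sj≡
  ... | suc b = countBelow-< bps b∈ (≤-pred si<sj) sj≤si′
    where
    b≤n : b ≤ n
    b≤n = <⇒≤ (subst (_≤ n) sj≡ (proj₂ (s-range j)))
    b∈ : b ∈ bps
    b∈ = ∈-breakpoints⁺ b (≤-trans (proj₁ (s-range i)) (≤-pred si<sj)) b≤n
           (lucky⇒breakpoint b b≤n λ k sk≡ → let j≡k = s-injective j k (trans sj≡ (sym sk≡))
                                             in subst (λ k → a k ≡ s k) j≡k (trans lucky (sym sj≡)))

  block-<⇒s-< : ∀ i i′ → w i < w i′ → s i < s i′
  block-<⇒s-< i i′ wi<wi′ = let _ , si<sj , sj≤si′ , _ = block-<⇒lucky-between i i′ wi<wi′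
                            in <-≤-trans si<sj sj≤si′

  -- An unlucky car prefers a spot taken by an earlier car, so walking left through a run of
  -- unlucky cars goes back in time.
  run-arrival : ∀ i d j → s j ≡ s i + d → (∀ k → s i < s k → s k ≤ s j → a k ≢ s k) → toℕ i + d ≤ toℕ j
  run-arrival i zero    j sj≡ _ =
    ≤-reflexive (trans (+-identityʳ _) (cong toℕ (s-injective i j (sym (trans sj≡ (+-identityʳ _))))))
  run-arrival i (suc d) j sj≡ unlucky with lucky-or-next j
  ... | inj₁ lucky  = contradiction lucky (unlucky j si<sj ≤-refl)
    where si<sj = subst (s i <_) (sym sj≡) (m<m+n (s i) (s≤s z≤n))
  ... | inj₂ 1+a≡s =
    let j′ , j′<j , sj′≡a = a-taken-earlier j (λ a≡s → 1+n≢n (trans 1+a≡s (sym a≡s)))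
        aj≡ = suc-injective (trans 1+a≡s (trans sj≡ (+-suc (s i) d)))
        sj′≤sj = subst (_≤ s j) (sym sj′≡a) (a≤s j)
        IH = run-arrival i d j′ (trans sj′≡a aj≡) λ k si<sk sk≤sj′ → unlucky k si<sk (≤-trans sk≤sj′ sj′≤sj)
    in ≤-trans (≤-reflexive (+-suc (toℕ i) d)) (≤-trans (s≤s IH) j′<j)

  same-block-arrival : ∀ i j → w i ≡ w j → toℕ i < toℕ j → s i < s j
  same-block-arrival i j wi≡wj i<j with <-cmp (s i) (s j)
  ... | tri< si<sj _ _ = si<sj
  ... | tri≈ _ si≡sj _ = contradiction (cong toℕ (s-injective i j si≡sj)) (<⇒≢ i<j)
  ... | tri> _ _ sj<si = contradiction (≤-trans (m≤m+n (toℕ j) _) climb) (<⇒≱ i<j)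
    where
    climb : toℕ j + (s i ∸ s j) ≤ toℕ i
    climb = run-arrival j (s i ∸ s j) i (sym (m+[n∸m]≡n (<⇒≤ sj<si)))
              λ k sj<sk sk≤si lucky → <-irrefl (sym wi≡wj) (lucky-between⇒block-< j i k sj<sk sk≤si lucky)

  -- The blocks occupy consecutive intervals of spots, each filled in order of arrival.
  s-<⇔≺ : ∀ i j → s j < s i ⇔ j ≺ i
  s-<⇔≺ i j = mk⇔ s-<⇒≺ ≺⇒s-<
    where
    ≺⇒s-< : ∀ {i j} → j ≺ i → s j < s i
    ≺⇒s-< (inj₁ wj<wi)         = block-<⇒s-< _ _ wj<wi
    ≺⇒s-< (inj₂ (wj≡wi , j<i)) = same-block-arrival _ _ wj≡wi j<i
    s-<⇒≺ : s j < s i → j ≺ i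
    s-<⇒≺ sj<si with ≺-total j i (λ { refl → <-irrefl refl sj<si })
    ... | inj₁ j≺i = j≺i
    ... | inj₂ i≺j = contradiction (≺⇒s-< i≺j) (<⇒≯ sj<si)

  s≡1+rank : ∀ i → s i ≡ suc (rank i)
  s≡1+rank i = begin
    s i                                    ≡⟨ 1+pred-s ⟨
    suc (pred (s i))                       ≡⟨ cong suc (count-≤ (pred (s i)) (≤⇒pred≤ (proj₂ (s-range i)))) ⟨
    suc (count (λ j → s j ≤? pred (s i)))  ≡⟨ cong suc (count-cong _ (_≺? i) λ j → mk⇔
                                                (Equivalence.to (s-<⇔≺ i j) ∘ subst (suc (s j) ≤_) 1+pred-s ∘ s≤s)
                                                (<⇒≤pred ∘ Equivalence.from (s-<⇔≺ i j))) ⟩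
    suc (rank i)                           ∎
    where
    open ≡-Reasoning
    1+pred-s = suc-pred (s i) {{>-nonZero (proj₁ (s-range i))}}

  lucky⇒first : ∀ i → a i ≡ s i → earlier i ≡ 0
  lucky⇒first i lucky = count-none _ λ j (wj≡wi , j<i) →
    <-irrefl wj≡wi (lucky-between⇒block-< j i i (same-block-arrival j i wj≡wi j<i) ≤-refl lucky)

  unlucky⇒not-first : ∀ i → suc (a i) ≡ s i → 0 < earlier i
  unlucky⇒not-first i 1+a≡s =
    let j , j<i , sj≡a = a-taken-earlier i (λ a≡s → 1+n≢n (trans 1+a≡s (sym a≡s)))
    in count-pos (λ j → w j ≟ w i ×-dec toℕ j <? toℕ i) j (same-block j sj≡a , j<i)
    where
    same-block : ∀ j → s j ≡ a i → w j ≡ w i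
    same-block j sj≡a with <-cmp (w j) (w i)
    ... | tri≈ _ wj≡wi _ = wj≡wi
    ... | tri> _ _ wi<wj = contradiction (≤-trans (≤-reflexive sj≡a) (a≤s i)) (<⇒≱ (block-<⇒s-< i j wi<wj))
    ... | tri< wj<wi _ _ =
      let k , sj<sk , sk≤si , lucky = block-<⇒lucky-between j i wj<wi
          sk≡si = ≤-antisym sk≤si (subst (_≤ s k) (trans (cong suc sj≡a) 1+a≡s) sj<sk)
      in contradiction (trans (cong a (s-injective i k (sym sk≡si))) (trans lucky sk≡si))
                       (λ a≡s → 1+n≢n (trans 1+a≡s (sym a≡s)))

  a≡label : ∀ i → a i ≡ label i
  a≡label i with lucky-or-next i
  ... | inj₁ a≡s   = trans a≡s (trans (s≡1+rank i) (sym (label-first i (lucky⇒first i a≡s))))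
  ... | inj₂ 1+a≡s = trans (suc-injective (trans 1+a≡s (s≡1+rank i))) (sym (label-later i (unlucky⇒not-first i 1+a≡s)))

  β≡labelOf-blocks : β ≡ labelOf w
  β≡labelOf-blocks = trans (sym (tabulate∘lookup β)) (tabulate-cong a≡label)

  breakpoints-chain : Chain n 0 bps
  breakpoints-chain = chain n refl
    where
    chain : ∀ m → m ≡ n → Chain n 0 (List.filter (λ k → countLe k β ≟ k) (List.applyUpTo suc m))
    chain zero    0≡n = 0≡n
    chain (suc m) m+1≡n = filter-upTo-chain (λ k → countLe k β ≟ k) m suc (λ _ → n<1+n _) (s≤s z≤n) m+1≡n
      (subst (λ k → countLe k β ≡ k) (sym m+1≡n)
             (trans (length-filter≡count (_≤? n) β) (count-all _ (proj₂ ∘ a-range))))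

  content-after : ∀ p L → Chain n p L → ∀ m →
                  count (λ i → p <? s i ×-dec countBelow L (s i) ≟ m) ≡ nth (diffs p L) m
  content-after p [] refl m = count-none _ λ i (n<s , _) → <⇒≱ n<s (proj₂ (s-range i))
  content-after p (b ∷ L) (p<b , ch) zero = trans
    (count-cong _ (λ i → p <? s i ×-dec s i ≤? b) λ i → mk⇔
      (λ (p<s , none) → p<s , ≮⇒≥ λ b<s → <⇒≢ (countBelow-pos (b ∷ L) (here refl) b<s) (sym none))
      (λ (p<s , s≤b) → p<s , countBelow-≡0 (b ∷ L) (chain-≥ ch s≤b)))
    (count-interval p b (<⇒≤ p<b) (chain-≤ L ch))
  content-after p (b ∷ L) (p<b , ch) (suc m) = trans
    (count-cong _ (λ i → b <? s i ×-dec countBelow L (s i) ≟ m) λ i → mk⇔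
      (λ (p<s , cb≡) → let b<s = ≰⇒> λ s≤b → 0≢1+n (trans (sym (countBelow-≡0 (b ∷ L) (chain-≥ ch s≤b))) cb≡)
                       in b<s , suc-injective (trans (sym (countBelow-∷-< L b<s)) cb≡))
      (λ (b<s , cb≡) → <-trans p<b b<s , trans (countBelow-∷-< L b<s) (cong suc cb≡)))
    (content-after b L ch m)

  blocks-content : ∀ m → count (λ i → w i ≟ m) ≡ nth (componentLengths β) m
  blocks-content m = trans (count-cong _ (λ i → 0 <? s i ×-dec w i ≟ m) λ i → mk⇔ (proj₁ (s-range i) ,_) proj₂)
                           (content-after 0 bps breakpoints-chain m)

  componentLengths-sum : sum (componentLengths β) ≡ n
  componentLengths-sum = chain-sum bps breakpoints-chain

  componentLengths-pos : ∀ m → m < length (componentLengths β) → 0 < nth (componentLengths β) m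
  componentLengths-pos = chain-diffs-pos bps breakpoints-chain

-- The parking function labelled by a word

module Labelled {n} (u : Fin n → ℕ) where

  open Word u

  lookup-labelOf : ∀ i → lookup (labelOf u) i ≡ label i
  lookup-labelOf = lookup∘tabulate label

  s′ : Fin n → ℕ
  s′ i = lookup (spots (labelOf u)) i

  earlier-witness : ∀ i r → r < earlier i → ∃[ j ] (toℕ j < toℕ i × rank j ≡ below i + r)
  earlier-witness i r r<e =
    let ri≡ = rank≡below+earlier i
        j , rj≡ = rank-onto (below i + r) (<-trans (subst (below i + r <_) (sym ri≡) (+-monoʳ-< (below i) r<e)) (rank<n i))
        rj<ri = subst₂ _<_ (sym rj≡) (sym ri≡) (+-monoʳ-< (below i) r<e)
        uj≡ui = same-letter (subst (below i ≤_) (sym rj≡) (m≤m+n _ _)) (<⇒≤ rj<ri)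
    in j , earlier-index (rank-<⇒≺ rj<ri) uj≡ui , rj≡
    where
    earlier-index : ∀ {j} → j ≺ i → u j ≡ u i → toℕ j < toℕ i
    earlier-index (inj₁ uj<ui)     uj≡ui = contradiction uj≡ui (<⇒≢ uj<ui)
    earlier-index (inj₂ (_ , j<i)) _     = j<i

  -- Induction on arrival: the first car of a letter finds its preferred spot 1 + rank free; a later
  -- one finds its preferred spot taken by the previous car with the same letter and parks just after.
  spots-labelOf : ∀ i → s′ i ≡ suc (rank i)
  spots-labelOf = WF.All.wfRec FinInduction.<-wellFounded 0ℓ (λ i → s′ i ≡ suc (rank i)) step
    where
    step : ∀ i → (∀ {j} → toℕ j < toℕ i → s′ j ≡ suc (rank j)) → s′ i ≡ suc (rank i)
    step i IH with parkGo-lookup [] (labelOf u) i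
    ... | occ , len , occ⇔ , s≡ = trans s≡ (trans (cong (firstFree (length occ) occ) (lookup-labelOf i)) (park (earlier i) refl))
      where
      fresh : suc (rank i) ∉ occ
      fresh x∈ with Equivalence.to (occ⇔ _) x∈
      ... | inj₂ (j , j<i , sj≡) = <-irrefl (cong toℕ (rank-injective j i (suc-injective (trans (sym (IH j<i)) sj≡)))) j<i
      park : ∀ e → earlier i ≡ e → firstFree (length occ) occ (label i) ≡ suc (rank i)
      park zero    e≡0 = trans (cong (firstFree (length occ) occ) (label-first i e≡0)) (firstFree-free (length occ) occ _ fresh)
      park (suc r) e≡  =
        let l≡ = label-later i (subst (0 <_) (sym e≡) (s≤s z≤n))
            j , j<i , rj≡ = earlier-witness i r (subst (r <_) (sym e≡) ≤-refl)
            taken = Equivalence.from (occ⇔ (label i)) (inj₂ (j , j<i ,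
                      trans (IH j<i) (trans (cong suc rj≡) (cong (λ e → suc (below i + pred e)) (sym e≡)))))
        in trans (firstFree-next (length occ) occ (label i) (subst (0 <_) (sym len) (≤-<-trans z≤n j<i)) taken
                   (subst (_∉ occ) (cong suc (sym l≡)) fresh))
                 (cong suc l≡)

  labelOf-unitInterval : IsUnitInterval n (labelOf u)
  labelOf-unitInterval = ((λ i → 1≤a′ i , ≤-trans (a′≤s′ i) (s′≤n i)) , s′≤n) , s′≤1+a′
    where
    1≤a′ : ∀ i → 1 ≤ lookup (labelOf u) i
    1≤a′ i = subst (1 ≤_) (sym (lookup-labelOf i)) (s≤s z≤n)
    s′≤n : ∀ i → s′ i ≤ n
    s′≤n i = subst (_≤ n) (sym (spots-labelOf i)) (rank<n i)
    a′≤s′ : ∀ i → lookup (labelOf u) i ≤ s′ i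
    a′≤s′ i = subst₂ _≤_ (sym (lookup-labelOf i)) (sym (spots-labelOf i)) (proj₂ (label-bounds i))
    s′≤1+a′ : ∀ i → s′ i ≤ suc (lookup (labelOf u) i)
    s′≤1+a′ i = subst₂ _≤_ (sym (spots-labelOf i)) (sym (cong suc (lookup-labelOf i))) (s≤s (proj₁ (label-bounds i)))

  open Blocks (labelOf u) labelOf-unitInterval using (lucky-between⇒block-<; block-<⇒lucky-between)
    renaming (w to u′; a to a′)

  lucky⇔first : ∀ j → a′ j ≡ s′ j ⇔ earlier j ≡ 0
  lucky⇔first j = mk⇔ lucky⇒first (λ e≡0 → trans (lookup-labelOf j) (trans (label-first j e≡0) (sym (spots-labelOf j))))
    where
    lucky⇒first : a′ j ≡ s′ j → earlier j ≡ 0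
    lucky⇒first lucky with earlier j ≟ 0
    ... | yes e≡0 = e≡0
    ... | no e≢0  = contradiction (trans (sym (label-later j (n≢0⇒n>0 e≢0)))
                                         (trans (sym (lookup-labelOf j)) (trans lucky (spots-labelOf j))))
                                  (1+n≢n ∘ sym)

  blocks-labelOf : SameOrder u′ u
  blocks-labelOf i i′ = mk⇔ block-<⇒< <⇒block-<
    where
    block-<⇒< : u′ i < u′ i′ → u i < u i′
    block-<⇒< u′i<u′i′ =
      let j , si<sj , sj≤si′ , lucky = block-<⇒lucky-between i i′ u′i<u′i′
          rj≡bj = rank-first j (Equivalence.to (lucky⇔first j) lucky)
          ri<rj = ≤-pred (subst₂ _<_ (spots-labelOf i) (spots-labelOf j) si<sj)
          rj≤ri′ = ≤-pred (subst₂ _≤_ (spots-labelOf j) (spots-labelOf i′) sj≤si′)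
      in <-≤-trans (rank-<-below⇒< (subst (rank i <_) rj≡bj ri<rj)) (≤-rank⇒≤ rj≤ri′)
    <⇒block-< : u i < u i′ → u′ i < u′ i′
    <⇒block-< ui<ui′ =
      let j , uj≡ , ej≡0 , rj≡ = first-occurrence i′
      in lucky-between⇒block-< i i′ j
           (subst₂ _<_ (sym (spots-labelOf i)) (sym (spots-labelOf j))
                   (s≤s (subst (rank i <_) (sym rj≡) (rank<below ui<ui′))))
           (subst₂ _≤_ (sym (spots-labelOf j)) (sym (spots-labelOf i′))
                   (s≤s (subst (_≤ rank i′) (sym rj≡) (below≤rank i′))))
           (Equivalence.from (lucky⇔first j) ej≡0)

-- Faces of the permutohedron

lookup-ext : ∀ {A : Set} {n} (x y : Vec A n) → (∀ i → lookup x i ≡ lookup y i) → x ≡ y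
lookup-ext x y x≗y = trans (sym (tabulate∘lookup x)) (trans (tabulate-cong x≗y) (tabulate∘lookup y))

permutationFrom : ∀ {n} (s : Fin n → ℕ) → (∀ i j → s i ≡ s j → i ≡ j) → (∀ i → 1 ≤ s i × s i ≤ n) →
                  Σ (Permutation′ n) λ π → ∀ i → suc (toℕ (π ⟨$⟩ʳ i)) ≡ s i
permutationFrom {n} s s-injective s-range = permutation f g f∘g g∘f , 1+f≡s
  where
  open InjectionOnto s s-injective s-range
  f : Fin n → Fin n
  f i = fromℕ< (≤-trans (≤-reflexive (suc-pred (s i) {{>-nonZero (proj₁ (s-range i))}})) (proj₂ (s-range i)))
  1+f≡s : ∀ i → suc (toℕ (f i)) ≡ s i
  1+f≡s i = trans (cong suc (Finₚ.toℕ-fromℕ< _)) (suc-pred (s i) {{>-nonZero (proj₁ (s-range i))}})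
  g : Fin n → Fin n
  g t = proj₁ (onto (toℕ t) (Finₚ.toℕ<n t))
  f∘g : ∀ t → f (g t) ≡ t
  f∘g t = Finₚ.toℕ-injective (suc-injective (trans (1+f≡s (g t)) (proj₂ (onto (toℕ t) (Finₚ.toℕ<n t)))))
  g∘f : ∀ i → g (f i) ≡ i
  g∘f i = s-injective _ _ (trans (sym (1+f≡s (g (f i)))) (trans (cong (suc ∘ toℕ) (f∘g (f i))) (1+f≡s i)))

vertex : ∀ {n} (π : Permutation′ n) (x : Vec ℕ n) → (∀ i → lookup x i ≡ suc (toℕ (π ⟨$⟩ʳ i))) → IsVertex n x
vertex π x x≡ = π , lookup-ext _ _ λ i → trans (x≡ i) (sym (lookup∘tabulate _ i))

lookup-vertex : ∀ {n} {x : Vec ℕ n} → (v : IsVertex n x) → ∀ i → lookup x i ≡ suc (toℕ (proj₁ v ⟨$⟩ʳ i))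
lookup-vertex (π , refl) i = lookup∘tabulate _ i

lookup-permCoords : ∀ {n} (τ : Permutation′ n) (y : Vec ℕ n) j → lookup (permCoords τ y) j ≡ lookup y (τ ⟨$⟩ˡ j)
lookup-permCoords τ y j = lookup∘tabulate _ j

permCoords-vertex : ∀ {n} (τ : Permutation′ n) {y : Vec ℕ n} → IsVertex n y → IsVertex n (permCoords τ y)
permCoords-vertex τ {y} v = vertex (flip τ ∘ₚ proj₁ v) _ λ j →
  trans (lookup-permCoords τ y j) (lookup-vertex v (τ ⟨$⟩ˡ j))

permCoords-flip : ∀ {n} (τ : Permutation′ n) (x : Vec ℕ n) → permCoords τ (permCoords (flip τ) x) ≡ x
permCoords-flip τ x = lookup-ext _ _ λ j →
  trans (lookup-permCoords τ (permCoords (flip τ) x) j) (trans (lookup-permCoords (flip τ) x _) (cong (lookup x) (inverseʳ τ)))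

InFace : ∀ {n} → (Fin n → ℕ) → Vec ℕ n → Set
InFace {n} u x = IsVertex n x × (∀ i i′ → u i < u i′ → lookup x i < lookup x i′)

module _ {n} (i j : Fin n) where

  transpose-matchˡ : PC.transpose i j i ≡ j
  transpose-matchˡ with i Finₚ.≟ i
  ... | yes _  = refl
  ... | no i≢i = contradiction refl i≢i

  transpose-matchʳ : PC.transpose i j j ≡ i
  transpose-matchʳ with j Finₚ.≟ i
  ... | yes j≡i = j≡i
  ... | no _ with j Finₚ.≟ j
  ...   | yes _  = refl
  ...   | no j≢j = contradiction refl j≢j

  transpose-invariant : ∀ (u : Fin n → ℕ) → u i ≡ u j → ∀ k → u (PC.transpose i j k) ≡ u k
  transpose-invariant u ui≡uj k with k Finₚ.≟ i
  ... | yes refl = sym ui≡uj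
  ... | no _ with k Finₚ.≟ j
  ...   | yes refl = ui≡uj
  ...   | no _     = refl

-- Swapping two coordinates carrying equal letters maps the face to itself.
face-determines-order : ∀ {n} (u : Fin n → ℕ) {x₀ : Vec ℕ n} → InFace u x₀ →
                        ∀ i i′ → (∀ x → InFace u x → lookup x i < lookup x i′) → u i < u i′
face-determines-order u {x₀} (v₀ , mono₀) i i′ all< with <-cmp (u i) (u i′) | i Finₚ.≟ i′
... | tri< ui<ui′ _ _ | _        = ui<ui′
... | tri> _ _ ui′<ui | _        = contradiction (mono₀ i′ i ui′<ui) (<-asym (all< x₀ (v₀ , mono₀)))
... | tri≈ _ _ _      | yes refl = contradiction (all< x₀ (v₀ , mono₀)) (<-irrefl refl)
... | tri≈ _ ui≡ui′ _ | no _     = contradiction (all< x₁ (permCoords-vertex τ v₀ , mono₁)) (<-asym swapped)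
  where
  τ = transpose i′ i
  x₁ = permCoords τ x₀
  mono₁ : ∀ k k′ → u k < u k′ → lookup x₁ k < lookup x₁ k′
  mono₁ k k′ uk<uk′ = subst₂ _<_ (sym (lookup-permCoords τ x₀ k)) (sym (lookup-permCoords τ x₀ k′))
    (mono₀ _ _ (subst₂ _<_ (sym (transpose-invariant i i′ u ui≡ui′ k)) (sym (transpose-invariant i i′ u ui≡ui′ k′))
                           uk<uk′))
  swapped : lookup x₁ i′ < lookup x₁ i
  swapped = subst₂ _<_ (sym (trans (lookup-permCoords τ x₀ i′) (cong (lookup x₀) (transpose-matchʳ i i′))))
                       (sym (trans (lookup-permCoords τ x₀ i) (cong (lookup x₀) (transpose-matchˡ i i′))))
                       (all< x₀ (v₀ , mono₀))

SameOrder⇒same-face : ∀ {n} {u u′ : Fin n → ℕ} → SameOrder u u′ → ∀ x → InFace u x ⇔ InFace u′ x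
SameOrder⇒same-face same x = mk⇔ (λ (v , mono) → v , λ i j → mono i j ∘ Equivalence.from (same i j))
                                 (λ (v , mono) → v , λ i j → mono i j ∘ Equivalence.to (same i j))

same-face⇒SameOrder : ∀ {n} {u u′ : Fin n → ℕ} {x₀} → InFace u x₀ →
                      (∀ x → InFace u x ⇔ InFace u′ x) → SameOrder u u′
same-face⇒SameOrder {u = u} {u′} x₀∈ same i j = mk⇔
  (λ ui<uj → face-determines-order u′ (Equivalence.to (same _) x₀∈) i j λ x x∈ →
               proj₂ (Equivalence.from (same x) x∈) i j ui<uj)
  (λ u′i<u′j → face-determines-order u x₀∈ i j λ x x∈ → proj₂ (Equivalence.to (same x) x∈) i j u′i<u′j)

permCoords-face : ∀ {n} (u : Fin n → ℕ) (τ : Permutation′ n) x →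
                  (∃[ y ] (InFace u y × x ≡ permCoords τ y)) ⇔ InFace (u ∘ (τ ⟨$⟩ˡ_)) x
permCoords-face u τ x = mk⇔ image preimage
  where
  image : ∃[ y ] (InFace u y × x ≡ permCoords τ y) → InFace (u ∘ (τ ⟨$⟩ˡ_)) x
  image (y , (v , mono) , refl) = permCoords-vertex τ v , λ j j′ uj<uj′ →
    subst₂ _<_ (sym (lookup-permCoords τ y j)) (sym (lookup-permCoords τ y j′)) (mono _ _ uj<uj′)
  preimage : InFace (u ∘ (τ ⟨$⟩ˡ_)) x → ∃[ y ] (InFace u y × x ≡ permCoords τ y)
  preimage (v , mono) = permCoords (flip τ) x , (permCoords-vertex (flip τ) v , mono′) , sym (permCoords-flip τ x)
    where
    mono′ : ∀ i i′ → u i < u i′ → lookup (permCoords (flip τ) x) i < lookup (permCoords (flip τ) x) i′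
    mono′ i i′ ui<ui′ = subst₂ _<_ (sym (lookup-permCoords (flip τ) x i)) (sym (lookup-permCoords (flip τ) x i′))
      (mono _ _ (subst₂ _<_ (sym (cong u (inverseˡ τ))) (sym (cong u (inverseˡ τ))) ui<ui′))

spots-InFace : ∀ {n} (β : Vec ℕ n) → IsUnitInterval n β → InFace (blockOf β) (spots β)
spots-InFace β β-ui = vertex π (spots β) (sym ∘ 1+π≡s) , block-<⇒s-<
  where
  open Blocks β β-ui
  π = proj₁ (permutationFrom s s-injective s-range)
  1+π≡s = proj₂ (permutationFrom s s-injective s-range)

InOrbit⇔ : ∀ {n} (α β : Vec ℕ n) →
           InOrbit n α β ⇔ (IsUnitInterval n β × ∃[ τ ] SameOrder (blockOf β) (blockOf α ∘ (τ ⟨$⟩ˡ_)))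
InOrbit⇔ α β = mk⇔ (λ (β-ui , τ , faces≡) → β-ui , τ , same-face⇒SameOrder (spots-InFace β β-ui) λ x →
                      ⇔.trans (mk⇔ (proj₁ (faces≡ x)) (proj₂ (faces≡ x))) (permCoords-face (blockOf α) τ x))
                   (λ (β-ui , τ , same) → β-ui , τ , λ x →
                      let β≡τα = ⇔.trans (SameOrder⇒same-face same x) (⇔.sym (permCoords-face (blockOf α) τ x))
                      in Equivalence.to β≡τα , Equivalence.from β≡τα)

-- Words of given content

HasContent : ∀ {n} → List ℕ → (Fin n → ℕ) → Set
HasContent c u = ∀ m → count (λ i → u i ≟ m) ≡ nth c m

nth-pos⇒< : ∀ c m → 0 < nth c m → m < length c
nth-pos⇒< (_ ∷ c) zero    _   = s≤s z≤n
nth-pos⇒< (_ ∷ c) (suc m) pos = s≤s (nth-pos⇒< c m pos)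

content-gapless : ∀ {n c} {u : Fin n → ℕ} → HasContent c u → (∀ m → m < length c → 0 < nth c m) → Gapless u
content-gapless {c = c} {u} content pos i m m<ui =
  count-witness (λ j → u j ≟ m) (subst (0 <_) (sym (content m)) (pos m (<-trans m<ui ui<ℓ)))
  where
  ui<ℓ = nth-pos⇒< c (u i) (subst (0 <_) (content (u i)) (count-pos (λ j → u j ≟ u i) i refl))

cumulative : List ℕ → ℕ → ℕ
cumulative c zero    = 0
cumulative c (suc l) = cumulative c l + nth c l

cumulative-mono : ∀ c {l l′} → l ≤ l′ → cumulative c l ≤ cumulative c l′
cumulative-mono c {l′ = zero}   z≤n = z≤n
cumulative-mono c {l′ = suc l′} l≤1+l′ with m≤n⇒m<n∨m≡n l≤1+l′
... | inj₁ l<1+l′ = ≤-trans (cumulative-mono c (≤-pred l<1+l′)) (m≤m+n _ _)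
... | inj₂ refl   = ≤-refl

module _ {n c} {u : Fin n → ℕ} (content : HasContent c u) where

  open Word u

  count-<≡cumulative : ∀ l → count (λ i → u i <? l) ≡ cumulative c l
  count-<≡cumulative zero    = count-none _ λ i ()
  count-<≡cumulative (suc l) = begin
    count (λ i → u i <? suc l)  ≡⟨ count-split _ (λ i → u i <? l) ⟩
    count (λ i → u i <? suc l ×-dec u i <? l) + count (λ i → u i <? suc l ×-dec ¬? (u i <? l))
      ≡⟨ cong₂ _+_ (count-cong _ (λ i → u i <? l) λ i → mk⇔ proj₂ λ ui<l → m<n⇒m<1+n ui<l , ui<l)
                   (count-cong _ (λ i → u i ≟ l) λ i →
                      mk⇔ (λ (ui≤l , ui≮l) → ≤-antisym (≤-pred ui≤l) (≮⇒≥ ui≮l))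
                          λ { refl → ≤-refl , <-irrefl refl }) ⟩
    count (λ i → u i <? l) + count (λ i → u i ≟ l)  ≡⟨ cong₂ _+_ (count-<≡cumulative l) (content l) ⟩
    cumulative c l + nth c l  ∎
    where open ≡-Reasoning

  rank-bounds : ∀ j → cumulative c (u j) ≤ rank j × rank j < cumulative c (suc (u j))
  rank-bounds j = subst (_≤ rank j) below≡ (below≤rank j) ,
    subst₂ _<_ (sym (rank≡below+earlier j)) (cong₂ _+_ below≡ (content (u j)))
      (+-monoʳ-< (below j) (count-strict _ (λ k → u k ≟ u j) (λ k → proj₁) j refl λ (_ , j<j) → <-irrefl refl j<j))
    where
    below≡ : below j ≡ cumulative c (u j)
    below≡ = count-<≡cumulative (u j)

same-rank⇒same-letter : ∀ {n c} {u u′ : Fin n → ℕ} → HasContent c u → HasContent c u′ →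
                        ∀ i j → Word.rank u i ≡ Word.rank u′ j → u i ≡ u′ j
same-rank⇒same-letter {c = c} {u} {u′} content content′ i j r≡ with <-cmp (u i) (u′ j)
... | tri≈ _ ui≡u′j _ = ui≡u′j
... | tri< ui<u′j _ _ = contradiction r≡ (<⇒≢ (<-≤-trans (proj₂ (rank-bounds content i))
                          (≤-trans (cumulative-mono c ui<u′j) (proj₁ (rank-bounds content′ j)))))
... | tri> _ _ u′j<ui = contradiction (sym r≡) (<⇒≢ (<-≤-trans (proj₂ (rank-bounds content′ j))
                          (≤-trans (cumulative-mono c u′j<ui) (proj₁ (rank-bounds content i)))))

rankPermutation : ∀ {n} (u : Fin n → ℕ) → Σ (Permutation′ n) λ π → ∀ i → toℕ (π ⟨$⟩ʳ i) ≡ Word.rank u i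
rankPermutation u = map₂ (λ 1+π≡ i → suc-injective (1+π≡ i))
  (permutationFrom (suc ∘ rank) (λ i j → rank-injective i j ∘ suc-injective) (λ i → s≤s z≤n , rank<n i))
  where open Word u

same-content⇒permutation : ∀ {n c} {u u′ : Fin n → ℕ} → HasContent c u → HasContent c u′ →
                           Σ (Permutation′ n) λ π → ∀ j → u′ j ≡ u (π ⟨$⟩ʳ j)
same-content⇒permutation {c = c} {u} {u′} content content′ =
  π′ ∘ₚ flip π , λ j → sym (same-rank⇒same-letter {c = c} content content′ _ j (begin
    Word.rank u (π ⟨$⟩ˡ (π′ ⟨$⟩ʳ j))            ≡⟨ rank≡π _ ⟨
    toℕ (π ⟨$⟩ʳ (π ⟨$⟩ˡ (π′ ⟨$⟩ʳ j)))          ≡⟨ cong toℕ (inverseʳ π) ⟩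
    toℕ (π′ ⟨$⟩ʳ j)                            ≡⟨ rank≡π′ j ⟩
    Word.rank u′ j                             ∎))
  where
  open ≡-Reasoning
  π = proj₁ (rankPermutation u)
  rank≡π = proj₂ (rankPermutation u)
  π′ = proj₁ (rankPermutation u′)
  rank≡π′ = proj₂ (rankPermutation u′)

Pick : Set
Pick = ℕ × ℕ × List ℕ

shift : ℕ → Pick → Pick
shift x (j , m , c′) = suc j , m , x ∷ c′

-- For every letter j with nth c j = m > 0, the pick (j , m , c′) where c′ is c with one j removed.
picks : List ℕ → List Pick
picks []          = []
picks (zero ∷ c)  = List.map (shift zero) (picks c)
picks (suc m ∷ c) = (0 , suc m , m ∷ c) ∷ List.map (shift (suc m)) (picks c)

words : (n : ℕ) → List ℕ → List (Vec ℕ n)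
prepend : (n : ℕ) → Pick → List (Vec ℕ (suc n))
words zero    c = [] ∷ []
words (suc n) c = List.concatMap (prepend n) (picks c)
prepend n (j , _ , c′) = List.map (j ∷_) (words n c′)

IsPick : List ℕ → Pick → Set
IsPick c (j , m , c′) = nth c j ≡ m × m ≡ suc (nth c′ j) × (∀ k → k ≢ j → nth c k ≡ nth c′ k)
                      × factorialProduct c ≡ m * factorialProduct c′ × sum c ≡ suc (sum c′)

picks-sound : ∀ c {p} → p ∈ picks c → IsPick c p
picks-sound (zero ∷ c) p∈ with ∈-map⁻ (shift zero) p∈
... | (j , m , c′) , p∈′ , refl =
  let c≡ , m≡ , others , fp≡ , sum≡ = picks-sound c p∈′
  in c≡ , m≡ , (λ { zero _ → refl ; (suc k) k≢ → others k (k≢ ∘ cong suc) }) ,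
     trans (+-identityʳ _) (trans fp≡ (cong (m *_) (sym (+-identityʳ _)))) , sum≡
picks-sound (suc m ∷ c) (here refl) = refl , refl , (λ { zero 0≢0 → contradiction refl 0≢0 ; (suc k) _ → refl }) ,
                                      *-assoc (suc m) (m !) (factorialProduct c) , refl
picks-sound (suc m₀ ∷ c) (there p∈) with ∈-map⁻ (shift (suc m₀)) p∈
... | (j , m , c′) , p∈′ , refl =
  let c≡ , m≡ , others , fp≡ , sum≡ = picks-sound c p∈′
  in c≡ , m≡ , (λ { zero _ → refl ; (suc k) k≢ → others k (k≢ ∘ cong suc) }) ,
     (begin
       suc m₀ ! * factorialProduct c          ≡⟨ cong (suc m₀ ! *_) fp≡ ⟩
       suc m₀ ! * (m * factorialProduct c′)   ≡⟨ x∙yz≈y∙xz (suc m₀ !) m _ ⟩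
       m * (suc m₀ ! * factorialProduct c′)   ∎) ,
     trans (cong (suc m₀ +_) sum≡) (+-suc (suc m₀) _)
  where open ≡-Reasoning

picks-complete : ∀ c j → 0 < nth c j → ∃[ c′ ] ((j , nth c j , c′) ∈ picks c)
picks-complete (zero ∷ c)  (suc j) pos = let c′ , p∈ = picks-complete c j pos in zero ∷ c′ , ∈-map⁺ (shift zero) p∈
picks-complete (suc m ∷ c) zero    _   = m ∷ c , here refl
picks-complete (suc m ∷ c) (suc j) pos =
  let c′ , p∈ = picks-complete c j pos in suc m ∷ c′ , there (∈-map⁺ (shift (suc m)) p∈)

words-unique : ∀ n c → Unique (words n c)
words-unique zero    c = [] ∷ []
words-unique (suc n) c = Uniqueₚ.concat⁺
  (Allₚ.map⁺ (All.tabulate {xs = picks c} λ _ → Uniqueₚ.map⁺ Vecₚ.∷-injectiveʳ (words-unique n _)))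
  (AllPairsₚ.map⁺ {f = prepend n} (AllPairs.map (λ {p} {p′} → disjoint {p} {p′}) (picks-distinct c)))
  where
  disjoint : ∀ {p p′ : Pick} → proj₁ p ≢ proj₁ p′ → Disjoint (prepend n p) (prepend n p′)
  disjoint {j , _} {j′ , _} j≢j′ (v∈ , v∈′) with ∈-map⁻ (j ∷_) v∈ | ∈-map⁻ (j′ ∷_) v∈′
  ... | _ , _ , refl | _ , _ , v≡ = j≢j′ (Vecₚ.∷-injectiveˡ v≡)
  picks-distinct : ∀ c → AllPairs (λ p p′ → proj₁ p ≢ proj₁ p′) (picks c)
  picks-distinct []          = []
  picks-distinct (zero ∷ c)  = AllPairsₚ.map⁺ (AllPairs.map (_∘ suc-injective) (picks-distinct c))
  picks-distinct (suc m ∷ c) =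
    Allₚ.map⁺ (All.tabulate λ _ ()) ∷ AllPairsₚ.map⁺ (AllPairs.map (_∘ suc-injective) (picks-distinct c))

sum≡0⇒nth≡0 : ∀ c → sum c ≡ 0 → ∀ m → nth c m ≡ 0
sum≡0⇒nth≡0 []         _     m       = refl
sum≡0⇒nth≡0 (zero ∷ c) sum≡0 zero    = refl
sum≡0⇒nth≡0 (zero ∷ c) sum≡0 (suc m) = sum≡0⇒nth≡0 c sum≡0 m

sum≡0⇒factorialProduct≡1 : ∀ c → sum c ≡ 0 → factorialProduct c ≡ 1
sum≡0⇒factorialProduct≡1 []         _     = refl
sum≡0⇒factorialProduct≡1 (zero ∷ c) sum≡0 = trans (+-identityʳ _) (sum≡0⇒factorialProduct≡1 c sum≡0)

∈-words⁻ : ∀ {n c} {v : Vec ℕ (suc n)} → v ∈ words (suc n) c →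
           ∃[ p ] (p ∈ picks c × ∃[ v′ ] (v ≡ proj₁ p ∷ v′ × v′ ∈ words n (proj₂ (proj₂ p))))
∈-words⁻ {n} {c} v∈ with (j , m , c′) , p∈ , v∈′ ← find (∈-concatMap⁻ (prepend n) {xs = picks c} v∈)
                    with v′ , v′∈ , refl ← ∈-map⁻ (j ∷_) v∈′ = (j , m , c′) , p∈ , v′ , refl , v′∈

words-sound : ∀ n c v → sum c ≡ n → v ∈ words n c → HasContent c (lookup v)
words-sound zero    c [] sum≡0 _  m = trans (count-none _ λ ()) (sym (sum≡0⇒nth≡0 c sum≡0 m))
words-sound (suc n) c v  sum≡  v∈ m with ∈-words⁻ {c = c} v∈
... | (j , k , c′) , p∈ , v′ , refl , v′∈ with picks-sound c p∈
...   | c≡ , k≡ , others , _ , sum≡′ with j ≟ m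
...     | yes refl = trans (count-head-yes (λ i → lookup (j ∷ v′) i ≟ m) refl) (trans (cong suc IH) (sym (trans c≡ k≡)))
  where IH = words-sound n c′ v′ (suc-injective (trans (sym sum≡′) sum≡)) v′∈ m
...     | no j≢m   = trans (count-head-no (λ i → lookup (j ∷ v′) i ≟ m) j≢m) (trans IH (sym (others m (j≢m ∘ sym))))
  where IH = words-sound n c′ v′ (suc-injective (trans (sym sum≡′) sum≡)) v′∈ m

HasContent-tail : ∀ {n c c′ x} {v : Vec ℕ n} →
                  nth c x ≡ suc (nth c′ x) → (∀ k → k ≢ x → nth c k ≡ nth c′ k) →
                  HasContent c (lookup (x ∷ v)) → HasContent c′ (lookup v)
HasContent-tail {x = x} {v} x-removed others content m with x ≟ m
... | yes refl = suc-injective (trans (sym (count-head-yes (λ i → lookup (x ∷ v) i ≟ m) refl)) (trans (content m) x-removed))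
... | no x≢m  = trans (sym (count-head-no (λ i → lookup (x ∷ v) i ≟ m) x≢m)) (trans (content m) (others m (x≢m ∘ sym)))

words-complete : ∀ n c v → HasContent c (lookup v) → v ∈ words n c
words-complete zero    c []       _       = here refl
words-complete (suc n) c (x ∷ v′) content
  with c′ , p∈ ← picks-complete c x (subst (0 <_) (content x) (count-pos (λ i → lookup (x ∷ v′) i ≟ x) zero refl))
  with _ , x-removed , others , _ ← picks-sound c p∈
  = ∈-concatMap⁺ (prepend n) (lose p∈ (∈-map⁺ (x ∷_)
      (words-complete n c′ v′ (HasContent-tail {c = c} {c′} x-removed others content))))

length-concatMap : ∀ {A B : Set} (f : A → List B) xs → length (List.concatMap f xs) ≡ sum (List.map (length ∘ f) xs)
length-concatMap f []       = refl
length-concatMap f (x ∷ xs) = trans (Listₚ.length-++ (f x)) (cong (length (f x) +_) (length-concatMap f xs))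

sum-map-*ʳ : ∀ {A : Set} (f : A → ℕ) xs k → sum (List.map f xs) * k ≡ sum (List.map (λ x → f x * k) xs)
sum-map-*ʳ f []       k = refl
sum-map-*ʳ f (x ∷ xs) k = trans (*-distribʳ-+ k (f x) _) (cong (f x * k +_) (sum-map-*ʳ f xs k))

multiplicity : Pick → ℕ
multiplicity (_ , m , _) = m

picks-sum : ∀ c → sum (List.map multiplicity (picks c)) ≡ sum c
picks-sum []          = refl
picks-sum (zero ∷ c)  = trans (cong sum (sym (Listₚ.map-∘ (picks c)))) (picks-sum c)
picks-sum (suc m ∷ c) = cong (suc m +_) (trans (cong sum (sym (Listₚ.map-∘ (picks c)))) (picks-sum c))

words-count : ∀ n c → sum c ≡ n → length (words n c) * factorialProduct c ≡ n !
words-count zero    c sum≡0 = cong (1 *_) (sum≡0⇒factorialProduct≡1 c sum≡0)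
words-count (suc n) c sum≡  = begin
  length (words (suc n) c) * factorialProduct c
    ≡⟨ cong (_* factorialProduct c) (length-concatMap (prepend n) (picks c)) ⟩
  sum (List.map (length ∘ prepend n) (picks c)) * factorialProduct c
    ≡⟨ sum-map-*ʳ (length ∘ prepend n) (picks c) (factorialProduct c) ⟩
  sum (List.map (λ p → length (prepend n p) * factorialProduct c) (picks c))
    ≡⟨ cong sum (Listₚ.map-cong-local (All.tabulate per-pick)) ⟩
  sum (List.map (λ p → multiplicity p * n !) (picks c))
    ≡⟨ sum-map-*ʳ multiplicity (picks c) (n !) ⟨
  sum (List.map multiplicity (picks c)) * n !
    ≡⟨ cong (_* n !) (trans (picks-sum c) sum≡) ⟩
  suc n * n ! ∎
  where
  open ≡-Reasoning
  per-pick : ∀ {p} → p ∈ picks c → length (prepend n p) * factorialProduct c ≡ multiplicity p * n !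
  per-pick {j , m , c′} p∈ = let _ , _ , _ , fp≡ , sum≡′ = picks-sound c p∈ in begin
    length (List.map (j ∷_) (words n c′)) * factorialProduct c
      ≡⟨ cong₂ _*_ (Listₚ.length-map (j ∷_) (words n c′)) fp≡ ⟩
    length (words n c′) * (m * factorialProduct c′)
      ≡⟨ x∙yz≈y∙xz (length (words n c′)) m _ ⟩
    m * (length (words n c′) * factorialProduct c′)
      ≡⟨ cong (m *_) (words-count n c′ (suc-injective (trans (sym sum≡′) sum≡))) ⟩
    m * n ! ∎

-- The orbit

Unique-map-∈ : ∀ {A B : Set} (f : A → B) {xs} → Unique xs →
               (∀ {x y} → x ∈ xs → y ∈ xs → f x ≡ f y → x ≡ y) →
               Unique (List.map f xs)
Unique-map-∈ f []         _   = []
Unique-map-∈ f (x∉ ∷ uxs) inj =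
  Allₚ.map⁺ (All.tabulate λ y∈ fx≡fy → All.lookup x∉ y∈ (inj (here refl) (there y∈) fx≡fy))
  ∷ Unique-map-∈ f uxs λ x∈ y∈ → inj (there x∈) (there y∈)

module OrbitOf {n} (α : Vec ℕ n) (α-ui : IsUnitInterval n α) where

  open Blocks α α-ui using (blocks-content; componentLengths-sum; componentLengths-pos)

  c : List ℕ
  c = componentLengths α

  orbit : List (Vec ℕ n)
  orbit = List.map (labelOf ∘ lookup) (words n c)

  orbit-length : length orbit * factorialProduct c ≡ n !
  orbit-length = trans (cong (_* factorialProduct c) (Listₚ.length-map _ (words n c)))
                       (words-count n c componentLengths-sum)

  content-words : ∀ {v} → v ∈ words n c → HasContent c (lookup v)
  content-words {v} = words-sound n c v componentLengths-sum

  labels-injective : ∀ {v v′} → v ∈ words n c → v′ ∈ words n c → labelOf (lookup v) ≡ labelOf (lookup v′) → v ≡ v′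
  labels-injective {v} {v′} v∈ v′∈ labels≡ =
    lookup-ext v v′ (SameOrder⇒≗ (gapless v∈) (gapless v′∈) (SameOrder-trans
      (SameOrder-sym (Labelled.blocks-labelOf (lookup v)))
      (SameOrder-trans (≗⇒SameOrder λ i → cong (λ β → blockOf β i) labels≡) (Labelled.blocks-labelOf (lookup v′)))))
    where
    gapless : ∀ {v} → v ∈ words n c → Gapless (lookup v)
    gapless v∈ = content-gapless {c = c} (content-words v∈) componentLengths-pos

  orbit-unique : Unique orbit
  orbit-unique = Unique-map-∈ (labelOf ∘ lookup) (words-unique n c) labels-injective

  word-InOrbit : ∀ {v} → v ∈ words n c → InOrbit n α (labelOf (lookup v))
  word-InOrbit {v} v∈ =
    let π , v≗wπ = same-content⇒permutation {c = c} {blockOf α} {lookup v} blocks-content (content-words v∈)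
    in Equivalence.from (InOrbit⇔ α (labelOf (lookup v))) (Labelled.labelOf-unitInterval (lookup v) , flip π ,
         SameOrder-trans {u′ = lookup v} (Labelled.blocks-labelOf (lookup v)) (≗⇒SameOrder v≗wπ))

  ∈⇒InOrbit : ∀ β → β ∈ orbit → InOrbit n α β
  ∈⇒InOrbit β β∈ = let v , v∈ , β≡ = ∈-map⁻ (labelOf ∘ lookup) β∈
                   in subst (InOrbit n α) (sym β≡) (word-InOrbit v∈)

  permuted-blocks-∈-words : ∀ τ → tabulate (blockOf α ∘ (τ ⟨$⟩ˡ_)) ∈ words n c
  permuted-blocks-∈-words τ = words-complete n c _ λ m →
    trans (count-cong _ (λ i → blockOf α (τ ⟨$⟩ˡ i) ≟ m) λ i →
             mk⇔ (subst (_≡ m) (lookup∘tabulate _ i)) (subst (_≡ m) (sym (lookup∘tabulate _ i))))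
          (trans (count-permute (λ i → blockOf α i ≟ m) (flip τ)) (blocks-content m))

  InOrbit⇒∈ : ∀ β → InOrbit n α β → β ∈ orbit
  InOrbit⇒∈ β β∈ =
    let β-ui , τ , same = Equivalence.to (InOrbit⇔ α β) β∈
        β≡ = trans (Blocks.β≡labelOf-blocks β β-ui)
                   (labelOf-cong (SameOrder-trans same (≗⇒SameOrder λ i → sym (lookup∘tabulate _ i))))
    in subst (_∈ orbit) (sym β≡) (∈-map⁺ (labelOf ∘ lookup) (permuted-blocks-∈-words τ))

corollary3p14 : (n : ℕ) (α : Vec ℕ n) → IsUnitInterval n α →
    ∃[ orbit ] (Unique orbit × (∀ β → (β ∈ orbit) ⇔ InOrbit n α β)
    × length orbit * factorialProduct (componentLengths α) ≡ n !)
corollary3p14 n α α-ui = orbit , orbit-unique , (λ β → mk⇔ (∈⇒InOrbit β) (InOrbit⇒∈ β)) , orbit-length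
  where open OrbitOf α α-ui
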